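{- Let $\mathcal{D}\subset\mathbb{Z}$ be a nonempty set such that $0\in\mathcal{D}$ or $\mathcal{D}=-\mathcal{D}$ (where $-\mathcal{D}=\{ -x: x\in\mathcal{D}\}$). Suppose $P\in\mathbb{Z}[X]$ divides some nonzero polynomial all of whose coefficients belong to $\mathcal{D}$. Then for every integer $n>1$, the product $P(X)\Phi_n(X)$, where $\Phi_n$ is the $n$-th cyclotomic polynomial, also divides some nonzero polynomial all of whose coefficients belong to $\mathcal{D}$. If moreover $\mathcal{D}=-\mathcal{D}$, the same holds for $n=1$, i.e. $P(X)(X-1)$ divides some nonzero polynomial all of whose coefficients belong to $\mathcal{D}$.
   Context: A polynomial $a_dX^d+\dots+a_0$ with $a_d\neq 0$ has all its coefficients in $\mathcal{D}$ if $a_j\in\mathcal{D}$ for every $0\le j\le d$. -}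

module Defs where

open import Data.Nat as ℕ using (ℕ; zero; suc; _∸_; _<ᵇ_; _≤_)
open import Data.Nat.Divisibility using (_∣?_)
open import Data.Integer as ℤ using (ℤ; +_; -[1+_]; _≟_)
open import Data.List using (List; []; _∷_; map; replicate; _++_; length; foldr)
open import Data.Product using (Σ; ∃; _×_; _,_; proj₂)
open import Data.Bool using (Bool; true; false; if_then_else_)
open import Relation.Nullary using (¬_; yes; no)
open import Relation.Binary.PropositionalEquality using (_≡_)

-- Polynomials in ℤ[X] as little-endian coefficient lists: a₀ ∷ a₁ ∷ … .
-- Trailing zeros are allowed; equality is coefficientwise (see _≈ₚ_).
Poly : Set
Poly = List ℤ

coeff : Poly → ℕ → ℤ
coeff []       _       = + 0
coeff (a ∷ p)  zero    = a
coeff (a ∷ p)  (suc i) = coeff p i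

_+ₚ_ : Poly → Poly → Poly
[]      +ₚ q       = q
(a ∷ p) +ₚ []      = a ∷ p
(a ∷ p) +ₚ (b ∷ q) = (a ℤ.+ b) ∷ (p +ₚ q)

-ₚ_ : Poly → Poly
-ₚ p = map ℤ.-_ p

_-ₚ_ : Poly → Poly → Poly
p -ₚ q = p +ₚ (-ₚ q)

_*ₚ_ : Poly → Poly → Poly
[]      *ₚ q = []
(a ∷ p) *ₚ q = map (a ℤ.*_) q +ₚ (+ 0 ∷ (p *ₚ q))

infixl 6 _+ₚ_ _-ₚ_
infixl 7 _*ₚ_

Xpow : ℕ → Poly
Xpow n = replicate n (+ 0) ++ (+ 1 ∷ [])

oneₚ : Poly
oneₚ = + 1 ∷ []

X-1 : Poly
X-1 = -[1+ 0 ] ∷ + 1 ∷ []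

_≈ₚ_ : Poly → Poly → Set
p ≈ₚ q = ∀ i → coeff p i ≡ coeff q i

_∣ₚ_ : Poly → Poly → Set
p ∣ₚ r = Σ Poly λ q → (p *ₚ q) ≈ₚ r

NonZeroPoly : Poly → Set
NonZeroPoly r = ∃ λ i → ¬ (coeff r i ≡ + 0)

-- All coefficients a₀,…,a_d (d = degree) of r lie in D:
-- the index j is ≤ d iff some coefficient at an index k ≥ j is nonzero.
CoeffsIn : (ℤ → Set) → Poly → Set
CoeffsIn D r = ∀ j → (∃ λ k → j ≤ k × ¬ (coeff r k ≡ + 0)) → D (coeff r j)

-- Cyclotomic polynomials, computed via  X^n - 1 = ∏_{d ∣ n} Φ_d,
-- i.e. Φ_n = (X^n - 1) / ∏_{d ∣ n, d < n} Φ_d  (exact division by a monic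
-- polynomial, implemented by long division).

normalize : Poly → Poly
normalize = foldr step []
  where
  step : ℤ → Poly → Poly
  step a [] with a ≟ + 0
  ... | yes _ = []
  ... | no  _ = a ∷ []
  step a (b ∷ q) = a ∷ b ∷ q

lastOr : ℤ → Poly → ℤ
lastOr d []      = d
lastOr d (a ∷ p) = lastOr a p

-- quotient of long division of A by a monic B (fuel-bounded)
divMonic : ℕ → Poly → Poly → Poly
divMonic zero    A B = []
divMonic (suc f) A B = go (normalize A) (normalize B)
  where
  go : Poly → Poly → Poly
  go [] b = []
  go (x ∷ a) b =
    if length (x ∷ a) <ᵇ length b then []
    else (let t = replicate (length (x ∷ a) ∸ length b) (+ 0) ++ (lastOr x a ∷ [])
          in t +ₚ divMonic f ((x ∷ a) -ₚ (t *ₚ b)) b)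

productₚ : List Poly → Poly
productₚ = foldr _*ₚ_ oneₚ

cycloList : ℕ → List (ℕ × Poly)
cycloList zero    = []
cycloList (suc k) = L ++ ((suc k , Φ) ∷ [])
  where
  L : List (ℕ × Poly)
  L = cycloList k
  divisorsΦ : List (ℕ × Poly) → List Poly
  divisorsΦ [] = []
  divisorsΦ ((d , φ) ∷ r) with d ∣? suc k
  ... | yes _ = φ ∷ divisorsΦ r
  ... | no  _ = divisorsΦ r
  XnMinus1 : Poly
  XnMinus1 = Xpow (suc k) -ₚ oneₚ
  Φ : Poly
  Φ = divMonic (suc (length XnMinus1)) XnMinus1 (productₚ (divisorsΦ L))

lastPair : List (ℕ × Poly) → Poly
lastPair []            = oneₚ
lastPair ((_ , φ) ∷ []) = φ
lastPair (_ ∷ x ∷ r)   = lastPair (x ∷ r)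

-- Φ_n, the n-th cyclotomic polynomial (meaningful for n ≥ 1).
cyclotomic : ℕ → Poly
cyclotomic n = lastPair (cycloList n)

-- For m > deg F, the coefficients of F · (1 + X^m + ⋯ + X^((n-1)m)) are n copies of those of F,
-- separated by zeros (none when m = deg F + 1).  If 0 ∈ D, take m ≡ 1 (mod n): then the second
-- factor is ≡ 1 + X + ⋯ + X^(n-1) modulo X^n - 1, hence divisible by Φ_n for n > 1.  If D = -D,
-- take m = deg F + 1 and append n copies of -F, i.e. multiply further by 1 - X^(nm), which is
-- divisible by X^n - 1 and so by Φ_n and by X - 1.
-- Most of the work is to show that Φ_n, defined as the quotient of X^n - 1 by ∏_{d ∣ n, d < n} Φ_d,
-- is monic with ∏_{d ∣ n} Φ_d = X^n - 1; this uses that distinct Φ_a, Φ_b are coprime over ℚ.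
module Submission where

open import Defs
open import Data.Bool using (false)
open import Data.Integer as ℤ using (ℤ; +_; _+_; _*_; -_; _-_)
import Data.Integer.Properties as ℤ
open import Data.List using (List; []; _∷_; map; drop; length; replicate; _++_; filter; applyUpTo)
import Data.List.Properties as List
open import Data.Maybe using (Maybe; just; nothing)
open import Data.Nat as ℕ using (ℕ; zero; suc; _≤_; _<_; z≤n; s≤s)
import Data.Nat.Divisibility as ℕ
open import Data.Nat.GCD using (gcd; gcd-GCD; gcd[m,n]∣m; gcd[m,n]∣n; module Bézout)
open import Data.Nat.Induction using (<-rec)
import Data.Nat.Properties as ℕ
open import Data.Product using (Σ; ∃; _×_; _,_; proj₁; proj₂)
open import Data.Sum using (_⊎_; inj₁; inj₂)
open import Data.Unit using (⊤; tt)
open import Function using (_∘_)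
open import Level using (0ℓ)
open import Relation.Binary.Bundles using (Setoid)
open import Relation.Binary.PropositionalEquality
import Relation.Binary.Reasoning.Setoid as SetoidReasoning
open import Relation.Nullary using (¬_; yes; no; contradiction)
open import Algebra.Bundles using (CommutativeRing; CommutativeSemigroup)
import Algebra.Properties.CommutativeSemigroup as CommutativeSemigroupProperties
import Algebra.Properties.CommutativeSemigroup.Divisibility as CommutativeSemigroupDivisibility
import Algebra.Properties.Semiring.Divisibility as SemiringDivisibility
open import Tactic.RingSolver using (solve-∀)
open import Tactic.RingSolver.Core.AlmostCommutativeRing using (AlmostCommutativeRing; fromCommutativeRing)

-- The ring ℤ[X]

-- _≈ₚ_ as a record, so that both polynomials can be recovered from a proof.
infix 4 _≈_
record _≈_ (p q : Poly) : Set where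
  constructor pointwise
  field coeff-≡ : ∀ i → coeff p i ≡ coeff q i
open _≈_

≈-refl : ∀ {p} → p ≈ p
≈-refl = pointwise λ _ → refl

≈-sym : ∀ {p q} → p ≈ q → q ≈ p
≈-sym e = pointwise λ i → sym (coeff-≡ e i)

≈-trans : ∀ {p q r} → p ≈ q → q ≈ r → p ≈ r
≈-trans e f = pointwise λ i → trans (coeff-≡ e i) (coeff-≡ f i)

≈-reflexive : ∀ {p q} → p ≡ q → p ≈ q
≈-reflexive refl = ≈-refl

∷-cong : ∀ {a b p q} → a ≡ b → p ≈ q → a ∷ p ≈ b ∷ q
∷-cong a≡b p≈q = pointwise λ where
  zero    → a≡b
  (suc i) → coeff-≡ p≈q i

tail-≈ : ∀ {a p q} → a ∷ p ≈ q → p ≈ drop 1 q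
tail-≈ {q = []}    e = pointwise λ i → coeff-≡ e (suc i)
tail-≈ {q = b ∷ q} e = pointwise λ i → coeff-≡ e (suc i)

[]≈0∷[] : [] ≈ + 0 ∷ []
[]≈0∷[] = pointwise λ where
  zero    → refl
  (suc i) → refl

≈-setoid : Setoid 0ℓ 0ℓ
≈-setoid = record { _≈_ = _≈_ ; isEquivalence = record { refl = ≈-refl ; sym = ≈-sym ; trans = ≈-trans } }

module ≈-Reasoning = SetoidReasoning ≈-setoid

coeff-+ : ∀ p q i → coeff (p +ₚ q) i ≡ coeff p i + coeff q i
coeff-+ []      q       i       = sym (ℤ.+-identityˡ _)
coeff-+ (a ∷ p) []      i       = sym (ℤ.+-identityʳ _)
coeff-+ (a ∷ p) (b ∷ q) zero    = refl
coeff-+ (a ∷ p) (b ∷ q) (suc i) = coeff-+ p q i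

coeff-map : ∀ (f : ℤ → ℤ) → f (+ 0) ≡ + 0 → ∀ p i → coeff (map f p) i ≡ f (coeff p i)
coeff-map f f0 []      i       = sym f0
coeff-map f f0 (a ∷ p) zero    = refl
coeff-map f f0 (a ∷ p) (suc i) = coeff-map f f0 p i

coeff-neg : ∀ p i → coeff (-ₚ p) i ≡ - coeff p i
coeff-neg = coeff-map -_ refl

+ₚ-cong : ∀ {p p' q q'} → p ≈ p' → q ≈ q' → p +ₚ q ≈ p' +ₚ q'
+ₚ-cong {p} {p'} {q} {q'} e f = pointwise λ i →
  trans (coeff-+ p q i) (trans (cong₂ _+_ (coeff-≡ e i) (coeff-≡ f i)) (sym (coeff-+ p' q' i)))

+ₚ-assoc : ∀ p q r → (p +ₚ q) +ₚ r ≈ p +ₚ (q +ₚ r)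
+ₚ-assoc p q r = pointwise λ i →
  trans (trans (coeff-+ (p +ₚ q) r i) (cong (_+ coeff r i) (coeff-+ p q i)))
  (trans (ℤ.+-assoc (coeff p i) (coeff q i) (coeff r i))
  (sym (trans (coeff-+ p (q +ₚ r) i) (cong (_+_ (coeff p i)) (coeff-+ q r i)))))

+ₚ-comm : ∀ p q → p +ₚ q ≈ q +ₚ p
+ₚ-comm p q = pointwise λ i →
  trans (coeff-+ p q i) (trans (ℤ.+-comm (coeff p i) (coeff q i)) (sym (coeff-+ q p i)))

+ₚ-identityʳ : ∀ p → p +ₚ [] ≈ p
+ₚ-identityʳ p = pointwise λ i → trans (coeff-+ p [] i) (ℤ.+-identityʳ _)

-ₚ-cong : ∀ {p q} → p ≈ q → -ₚ p ≈ -ₚ q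
-ₚ-cong {p} {q} e = pointwise λ i →
  trans (coeff-neg p i) (trans (cong -_ (coeff-≡ e i)) (sym (coeff-neg q i)))

-ₚ-inverseʳ : ∀ p → p +ₚ -ₚ p ≈ []
-ₚ-inverseʳ p = pointwise λ i →
  trans (coeff-+ p (-ₚ p) i) (trans (cong (_+_ (coeff p i)) (coeff-neg p i)) (ℤ.+-inverseʳ (coeff p i)))

-ₚ-inverseˡ : ∀ p → -ₚ p +ₚ p ≈ []
-ₚ-inverseˡ p = ≈-trans (+ₚ-comm (-ₚ p) p) (-ₚ-inverseʳ p)

+ₚ-commutativeSemigroup : CommutativeSemigroup 0ℓ 0ℓ
+ₚ-commutativeSemigroup = record
  { Carrier = Poly ; _≈_ = _≈_ ; _∙_ = _+ₚ_
  ; isCommutativeSemigroup = record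
    { isSemigroup = record
      { isMagma = record { isEquivalence = Setoid.isEquivalence ≈-setoid ; ∙-cong = +ₚ-cong }
      ; assoc = +ₚ-assoc }
    ; comm = +ₚ-comm } }

open CommutativeSemigroupProperties +ₚ-commutativeSemigroup
  using () renaming (interchange to +ₚ-interchange; x∙yz≈y∙xz to +ₚ-left-comm)

-- (a ∷ p) *ₚ q unfolds to a ·ₚ q +ₚ X· (p *ₚ q).

infixr 8 _·ₚ_
_·ₚ_ : ℤ → Poly → Poly
a ·ₚ p = map (a *_) p

X· : Poly → Poly
X· p = + 0 ∷ p

coeff-· : ∀ a p i → coeff (a ·ₚ p) i ≡ a * coeff p i
coeff-· a = coeff-map (a *_) (ℤ.*-zeroʳ a)

·ₚ-cong : ∀ a {p q} → p ≈ q → a ·ₚ p ≈ a ·ₚ q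
·ₚ-cong a {p} {q} e = pointwise λ i →
  trans (coeff-· a p i) (trans (cong (a *_) (coeff-≡ e i)) (sym (coeff-· a q i)))

·ₚ-distribˡ : ∀ a p q → a ·ₚ (p +ₚ q) ≈ a ·ₚ p +ₚ a ·ₚ q
·ₚ-distribˡ a p q = pointwise λ i →
  trans (coeff-· a (p +ₚ q) i) (trans (cong (a *_) (coeff-+ p q i))
  (trans (ℤ.*-distribˡ-+ a (coeff p i) (coeff q i))
  (sym (trans (coeff-+ (a ·ₚ p) (a ·ₚ q) i) (cong₂ _+_ (coeff-· a p i) (coeff-· a q i))))))

·ₚ-distribʳ : ∀ a b p → (a + b) ·ₚ p ≈ a ·ₚ p +ₚ b ·ₚ p
·ₚ-distribʳ a b p = pointwise λ i →
  trans (coeff-· (a + b) p i) (trans (ℤ.*-distribʳ-+ (coeff p i) a b)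
  (sym (trans (coeff-+ (a ·ₚ p) (b ·ₚ p) i) (cong₂ _+_ (coeff-· a p i) (coeff-· b p i)))))

·ₚ-assoc : ∀ a b p → (a * b) ·ₚ p ≈ a ·ₚ b ·ₚ p
·ₚ-assoc a b p = pointwise λ i →
  trans (coeff-· (a * b) p i) (trans (ℤ.*-assoc a b (coeff p i))
  (sym (trans (coeff-· a (b ·ₚ p) i) (cong (a *_) (coeff-· b p i)))))

·ₚ-identity : ∀ p → (+ 1) ·ₚ p ≈ p
·ₚ-identity p = pointwise λ i → trans (coeff-· (+ 1) p i) (ℤ.*-identityˡ _)

·ₚ-zero : ∀ p → (+ 0) ·ₚ p ≈ []
·ₚ-zero p = pointwise (coeff-· (+ 0) p)

·ₚ-X· : ∀ a p → a ·ₚ X· p ≈ X· (a ·ₚ p)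
·ₚ-X· a p = ∷-cong (ℤ.*-zeroʳ a) ≈-refl

X·[] : X· [] ≈ []
X·[] = ≈-sym []≈0∷[]

X·-cong : ∀ {p q} → p ≈ q → X· p ≈ X· q
X·-cong = ∷-cong refl

coeff-*ₚ-∷ : ∀ a p q i → coeff ((a ∷ p) *ₚ q) i ≡ a * coeff q i + coeff (X· (p *ₚ q)) i
coeff-*ₚ-∷ a p q i = trans (coeff-+ (a ·ₚ q) (X· (p *ₚ q)) i) (cong (_+ _) (coeff-· a q i))

*ₚ-zeroʳ : ∀ p → p *ₚ [] ≈ []
*ₚ-zeroʳ []      = ≈-refl
*ₚ-zeroʳ (a ∷ p) = ≈-trans (X·-cong (*ₚ-zeroʳ p)) X·[]

≈[]⇒*ₚ≈[] : ∀ {p} q → p ≈ [] → p *ₚ q ≈ []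
≈[]⇒*ₚ≈[] {[]}    q e = ≈-refl
≈[]⇒*ₚ≈[] {a ∷ p} q e = begin
  a ·ₚ q +ₚ X· (p *ₚ q)   ≈⟨ +ₚ-cong (≈-reflexive (cong (_·ₚ q) (coeff-≡ e 0)))
                                     (X·-cong (≈[]⇒*ₚ≈[] q (tail-≈ e))) ⟩
  (+ 0) ·ₚ q +ₚ X· []     ≈⟨ +ₚ-cong (·ₚ-zero q) X·[] ⟩
  []                      ∎
  where open ≈-Reasoning

*ₚ-congˡ : ∀ {p p'} q → p ≈ p' → p *ₚ q ≈ p' *ₚ q
*ₚ-congˡ {[]}    {p'}     q e = ≈-sym (≈[]⇒*ₚ≈[] q (≈-sym e))
*ₚ-congˡ {a ∷ p} {[]}     q e = ≈[]⇒*ₚ≈[] q e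
*ₚ-congˡ {a ∷ p} {b ∷ p'} q e =
  +ₚ-cong (≈-reflexive (cong (_·ₚ q) (coeff-≡ e 0))) (X·-cong (*ₚ-congˡ q (tail-≈ e)))

*ₚ-congʳ : ∀ p {q q'} → q ≈ q' → p *ₚ q ≈ p *ₚ q'
*ₚ-congʳ []      e = ≈-refl
*ₚ-congʳ (a ∷ p) e = +ₚ-cong (·ₚ-cong a e) (X·-cong (*ₚ-congʳ p e))

*ₚ-cong : ∀ {p p' q q'} → p ≈ p' → q ≈ q' → p *ₚ q ≈ p' *ₚ q'
*ₚ-cong {p' = p'} {q = q} e f = ≈-trans (*ₚ-congˡ q e) (*ₚ-congʳ p' f)

*ₚ-distribʳ : ∀ q p p' → (p +ₚ p') *ₚ q ≈ p *ₚ q +ₚ p' *ₚ q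
*ₚ-distribʳ q []      p'       = ≈-refl
*ₚ-distribʳ q (a ∷ p) []       = ≈-sym (+ₚ-identityʳ _)
*ₚ-distribʳ q (a ∷ p) (b ∷ p') = begin
  (a + b) ·ₚ q +ₚ X· ((p +ₚ p') *ₚ q)
    ≈⟨ +ₚ-cong (·ₚ-distribʳ a b q) (X·-cong (*ₚ-distribʳ q p p')) ⟩
  (a ·ₚ q +ₚ b ·ₚ q) +ₚ (X· (p *ₚ q) +ₚ X· (p' *ₚ q))
    ≈⟨ +ₚ-interchange (a ·ₚ q) (b ·ₚ q) (X· (p *ₚ q)) _ ⟩
  (a ∷ p) *ₚ q +ₚ (b ∷ p') *ₚ q ∎
  where open ≈-Reasoning

*ₚ-distribˡ : ∀ p q q' → p *ₚ (q +ₚ q') ≈ p *ₚ q +ₚ p *ₚ q'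
*ₚ-distribˡ []      q q' = ≈-refl
*ₚ-distribˡ (a ∷ p) q q' = begin
  a ·ₚ (q +ₚ q') +ₚ X· (p *ₚ (q +ₚ q'))
    ≈⟨ +ₚ-cong (·ₚ-distribˡ a q q') (X·-cong (*ₚ-distribˡ p q q')) ⟩
  (a ·ₚ q +ₚ a ·ₚ q') +ₚ (X· (p *ₚ q) +ₚ X· (p *ₚ q'))
    ≈⟨ +ₚ-interchange (a ·ₚ q) (a ·ₚ q') (X· (p *ₚ q)) _ ⟩
  (a ∷ p) *ₚ q +ₚ (a ∷ p) *ₚ q' ∎
  where open ≈-Reasoning

*ₚ-∷ʳ : ∀ p b q → p *ₚ (b ∷ q) ≈ b ·ₚ p +ₚ X· (p *ₚ q)
*ₚ-∷ʳ []      b q = []≈0∷[]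
*ₚ-∷ʳ (a ∷ p) b q = ∷-cong (cong (_+ + 0) (ℤ.*-comm a b)) (begin
  a ·ₚ q +ₚ p *ₚ (b ∷ q)              ≈⟨ +ₚ-cong ≈-refl (*ₚ-∷ʳ p b q) ⟩
  a ·ₚ q +ₚ (b ·ₚ p +ₚ X· (p *ₚ q))   ≈⟨ +ₚ-left-comm (a ·ₚ q) (b ·ₚ p) _ ⟩
  b ·ₚ p +ₚ (a ·ₚ q +ₚ X· (p *ₚ q))   ∎)
  where open ≈-Reasoning

*ₚ-comm : ∀ p q → p *ₚ q ≈ q *ₚ p
*ₚ-comm []      q = ≈-sym (*ₚ-zeroʳ q)
*ₚ-comm (a ∷ p) q = ≈-trans (+ₚ-cong ≈-refl (X·-cong (*ₚ-comm p q))) (≈-sym (*ₚ-∷ʳ q a p))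

·ₚ-*ₚ : ∀ a q r → (a ·ₚ q) *ₚ r ≈ a ·ₚ (q *ₚ r)
·ₚ-*ₚ a []      r = ≈-refl
·ₚ-*ₚ a (b ∷ q) r = begin
  (a * b) ·ₚ r +ₚ X· ((a ·ₚ q) *ₚ r)    ≈⟨ +ₚ-cong (·ₚ-assoc a b r) (X·-cong (·ₚ-*ₚ a q r)) ⟩
  a ·ₚ b ·ₚ r +ₚ X· (a ·ₚ (q *ₚ r))     ≈⟨ +ₚ-cong ≈-refl (≈-sym (·ₚ-X· a (q *ₚ r))) ⟩
  a ·ₚ b ·ₚ r +ₚ a ·ₚ X· (q *ₚ r)       ≈⟨ ≈-sym (·ₚ-distribˡ a (b ·ₚ r) (X· (q *ₚ r))) ⟩
  a ·ₚ ((b ∷ q) *ₚ r)                   ∎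
  where open ≈-Reasoning

X·-*ₚ : ∀ p q → X· p *ₚ q ≈ X· (p *ₚ q)
X·-*ₚ p q = +ₚ-cong (·ₚ-zero q) ≈-refl

*ₚ-assoc : ∀ p q r → (p *ₚ q) *ₚ r ≈ p *ₚ (q *ₚ r)
*ₚ-assoc []      q r = ≈-refl
*ₚ-assoc (a ∷ p) q r = begin
  (a ·ₚ q +ₚ X· (p *ₚ q)) *ₚ r          ≈⟨ *ₚ-distribʳ r (a ·ₚ q) _ ⟩
  (a ·ₚ q) *ₚ r +ₚ X· (p *ₚ q) *ₚ r     ≈⟨ +ₚ-cong (·ₚ-*ₚ a q r) (X·-*ₚ (p *ₚ q) r) ⟩
  a ·ₚ (q *ₚ r) +ₚ X· ((p *ₚ q) *ₚ r)   ≈⟨ +ₚ-cong ≈-refl (X·-cong (*ₚ-assoc p q r)) ⟩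
  (a ∷ p) *ₚ (q *ₚ r)                   ∎
  where open ≈-Reasoning

*ₚ-identityˡ : ∀ p → oneₚ *ₚ p ≈ p
*ₚ-identityˡ p = ≈-trans (+ₚ-cong (·ₚ-identity p) X·[]) (+ₚ-identityʳ p)

*ₚ-identityʳ : ∀ p → p *ₚ oneₚ ≈ p
*ₚ-identityʳ p = ≈-trans (*ₚ-comm p oneₚ) (*ₚ-identityˡ p)

ℤ[X] : CommutativeRing 0ℓ 0ℓ
ℤ[X] = record
  { Carrier = Poly ; _≈_ = _≈_ ; _+_ = _+ₚ_ ; _*_ = _*ₚ_ ; -_ = -ₚ_ ; 0# = [] ; 1# = oneₚ
  ; isCommutativeRing = record
    { isRing = record
      { +-isAbelianGroup = record
        { isGroup = record
          { isMonoid = record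
            { isSemigroup = CommutativeSemigroup.isSemigroup +ₚ-commutativeSemigroup
            ; identity = (λ _ → ≈-refl) , +ₚ-identityʳ }
          ; inverse = -ₚ-inverseˡ , -ₚ-inverseʳ
          ; ⁻¹-cong = -ₚ-cong }
        ; comm = +ₚ-comm }
      ; *-cong = *ₚ-cong
      ; *-assoc = *ₚ-assoc
      ; *-identity = *ₚ-identityˡ , *ₚ-identityʳ
      ; distrib = *ₚ-distribˡ , *ₚ-distribʳ }
    ; *-comm = *ₚ-comm } }

-- The solver compares normal forms syntactically; zero? lets it drop coefficients that compute to 0.
zero? : ∀ p → Maybe ([] ≈ p)
zero? []      = just ≈-refl
zero? (a ∷ p) with a ℤ.≟ + 0 | zero? p
... | yes refl | just e = just (≈-trans []≈0∷[] (∷-cong refl e))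
... | _        | _      = nothing

ℤ[X]ᴬ : AlmostCommutativeRing 0ℓ 0ℓ
ℤ[X]ᴬ = fromCommutativeRing ℤ[X] zero?

*ₚ-distrib-- : ∀ p q r → p *ₚ (q -ₚ r) ≈ p *ₚ q -ₚ p *ₚ r
*ₚ-distrib-- = solve-∀ ℤ[X]ᴬ

-ₚ-+ₚ-cancel : ∀ p q → (p -ₚ q) +ₚ q ≈ p
-ₚ-+ₚ-cancel = solve-∀ ℤ[X]ᴬ

p-[p-q]≈q : ∀ p q → p -ₚ (p -ₚ q) ≈ q
p-[p-q]≈q = solve-∀ ℤ[X]ᴬ

-- Degrees and monic polynomials

DegreeBelow : Poly → ℕ → Set
DegreeBelow p b = ∀ j → b ≤ j → coeff p j ≡ + 0

record Monic (p : Poly) (d : ℕ) : Set where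
  constructor _,_
  field
    leading : coeff p d ≡ + 1
    above   : DegreeBelow p (suc d)

degreeBelow-length : ∀ p → DegreeBelow p (length p)
degreeBelow-length []      j       _         = refl
degreeBelow-length (a ∷ p) (suc j) (s≤s l≤j) = degreeBelow-length p j l≤j

degreeBelow-resp-≈ : ∀ {p q b} → p ≈ q → DegreeBelow p b → DegreeBelow q b
degreeBelow-resp-≈ e bound j b≤j = trans (sym (coeff-≡ e j)) (bound j b≤j)

monic-resp-≈ : ∀ {p q d} → p ≈ q → Monic p d → Monic q d
monic-resp-≈ e (lead , bound) = trans (sym (coeff-≡ e _)) lead , degreeBelow-resp-≈ e bound

nonzero⇒<degreeBound : ∀ p {b j} → DegreeBelow p b → ¬ coeff p j ≡ + 0 → j < b
nonzero⇒<degreeBound p {b} {j} bound nz with j ℕ.<? b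
... | yes j<b = j<b
... | no  j≮b = contradiction (bound j (ℕ.≮⇒≥ j≮b)) nz

data DegreeView (p : Poly) : Set where
  zero-poly : p ≈ [] → DegreeView p
  of-degree : ∀ d → ¬ coeff p d ≡ + 0 → DegreeBelow p (suc d) → DegreeView p

degreeView : ∀ p → DegreeView p
degreeView []      = zero-poly ≈-refl
degreeView (a ∷ p) with degreeView p
... | of-degree d nz bound = of-degree (suc d) nz λ where (suc j) (s≤s d<j) → bound j d<j
... | zero-poly p≈[] with a ℤ.≟ + 0
...   | yes refl = zero-poly (≈-trans (X·-cong p≈[]) X·[])
...   | no  a≢0  = of-degree 0 a≢0 λ where (suc j) _ → coeff-≡ p≈[] j

nonZero⇒degree : ∀ F → NonZeroPoly F → ∃ λ d → ¬ coeff F d ≡ + 0 × DegreeBelow F (suc d)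
nonZero⇒degree F (i , Fᵢ≢0) with degreeView F
... | zero-poly F≈[]    = contradiction (coeff-≡ F≈[] i) Fᵢ≢0
... | of-degree d nz bound = d , nz , bound

*ₚ-leading : ∀ p m q t → DegreeBelow p (suc m) → DegreeBelow q (suc t) →
  coeff (p *ₚ q) (m ℕ.+ t) ≡ coeff p m * coeff q t × DegreeBelow (p *ₚ q) (suc (m ℕ.+ t))
*ₚ-leading []      m       q t _     _      = sym (ℤ.*-zeroˡ (coeff q t)) , λ _ _ → refl
*ₚ-leading (a ∷ p) zero    q t bound qBound = lead , above
  where
  p≈[] : p ≈ []
  p≈[] = pointwise λ j → bound (suc j) (s≤s z≤n)
  ≈a·q : (a ∷ p) *ₚ q ≈ a ·ₚ q
  ≈a·q = ≈-trans (+ₚ-cong ≈-refl (≈-trans (X·-cong (≈[]⇒*ₚ≈[] q p≈[])) X·[])) (+ₚ-identityʳ _)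
  lead = trans (coeff-≡ ≈a·q t) (coeff-· a q t)
  above : DegreeBelow ((a ∷ p) *ₚ q) (suc t)
  above j t<j = trans (coeff-≡ ≈a·q j) (trans (coeff-· a q j) (trans (cong (a *_) (qBound j t<j)) (ℤ.*-zeroʳ a)))
*ₚ-leading (a ∷ p) (suc m) q t bound qBound = lead , above
  where
  ih = *ₚ-leading p m q t (λ j m<j → bound (suc j) (s≤s m<j)) qBound
  lower : ∀ j → t < j → a * coeff q j + coeff (X· (p *ₚ q)) j ≡ coeff (X· (p *ₚ q)) j
  lower j t<j = trans (cong (_+ _) (trans (cong (a *_) (qBound j t<j)) (ℤ.*-zeroʳ a))) (ℤ.+-identityˡ _)
  lead = trans (coeff-*ₚ-∷ a p q (suc (m ℕ.+ t))) (trans (lower (suc (m ℕ.+ t)) (s≤s (ℕ.m≤n+m t m))) (proj₁ ih))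
  above : DegreeBelow ((a ∷ p) *ₚ q) (suc (suc (m ℕ.+ t)))
  above (suc j) (s≤s m+t<j) = trans (coeff-*ₚ-∷ a p q (suc j))
    (trans (lower (suc j) (s≤s (ℕ.≤-trans (ℕ.m≤n+m t m) (ℕ.<⇒≤ m+t<j)))) (proj₂ ih j m+t<j))

monic-*ₚ-lead : ∀ {M m} Q t → Monic M m → DegreeBelow Q (suc t) →
  coeff (M *ₚ Q) (m ℕ.+ t) ≡ coeff Q t × DegreeBelow (M *ₚ Q) (suc (m ℕ.+ t))
monic-*ₚ-lead {M} {m} Q t (lead , bound) qBound with *ₚ-leading M m Q t bound qBound
... | top , above = trans top (trans (cong (_* coeff Q t) lead) (ℤ.*-identityˡ _)) , above

monic-*ₚ : ∀ {p m q t} → Monic p m → Monic q t → Monic (p *ₚ q) (m ℕ.+ t)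
monic-*ₚ {q = q} {t} p-monic (lead , bound) with monic-*ₚ-lead q t p-monic bound
... | top , above = trans top lead , above

monic-*ₚ-≈[] : ∀ {M m Q} → Monic M m → M *ₚ Q ≈ [] → Q ≈ []
monic-*ₚ-≈[] {Q = Q} M-monic MQ≈[] with degreeView Q
... | zero-poly Q≈[]    = Q≈[]
... | of-degree t nz bound = contradiction (trans (sym (proj₁ (monic-*ₚ-lead Q t M-monic bound))) (coeff-≡ MQ≈[] _)) nz

monic-*ₚ-cancelˡ : ∀ {M m Q₁ Q₂} → Monic M m → M *ₚ Q₁ ≈ M *ₚ Q₂ → Q₁ ≈ Q₂
monic-*ₚ-cancelˡ {M} {m} {Q₁} {Q₂} M-monic e = begin
  Q₁                      ≈⟨ ≈-sym (p-[p-q]≈q Q₂ Q₁) ⟩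
  Q₂ -ₚ (Q₂ -ₚ Q₁)        ≈⟨ +ₚ-cong ≈-refl (-ₚ-cong (monic-*ₚ-≈[] {M} M-monic difference)) ⟩
  Q₂ -ₚ []                ≈⟨ +ₚ-identityʳ Q₂ ⟩
  Q₂                      ∎
  where
  open ≈-Reasoning
  difference : M *ₚ (Q₂ -ₚ Q₁) ≈ []
  difference = begin
    M *ₚ (Q₂ -ₚ Q₁)           ≈⟨ *ₚ-distrib-- M Q₂ Q₁ ⟩
    M *ₚ Q₂ -ₚ M *ₚ Q₁        ≈⟨ +ₚ-cong (≈-sym e) ≈-refl ⟩
    M *ₚ Q₁ -ₚ M *ₚ Q₁        ≈⟨ -ₚ-inverseʳ (M *ₚ Q₁) ⟩
    []                        ∎

1≢0 : ¬ (+ 1 ≡ + 0)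
1≢0 ()

monic-quotient : ∀ {B m A n Q} → Monic B m → Monic A n → B *ₚ Q ≈ A → Σ ℕ λ t → m ℕ.+ t ≡ n × Monic Q t
monic-quotient {B} {m} {A} {n} {Q} B-monic (A-lead , A-above) BQ≈A with degreeView Q
... | zero-poly Q≈[] = contradiction (trans (sym A-lead) (coeff-≡ A≈[] n)) 1≢0
  where A≈[] = ≈-trans (≈-sym BQ≈A) (≈-trans (*ₚ-congʳ B Q≈[]) (*ₚ-zeroʳ B))
... | of-degree t nz bound = t , m+t≡n , record { leading = Q-lead ; above = bound }
  where
  top = monic-*ₚ-lead Q t B-monic bound
  A-top : coeff A (m ℕ.+ t) ≡ coeff Q t
  A-top = trans (sym (coeff-≡ BQ≈A _)) (proj₁ top)
  m+t≡n : m ℕ.+ t ≡ n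
  m+t≡n = ℕ.≤-antisym
    (ℕ.≤-pred (nonzero⇒<degreeBound A A-above λ z → nz (trans (sym A-top) z)))
    (ℕ.≤-pred (nonzero⇒<degreeBound A (degreeBelow-resp-≈ BQ≈A (proj₂ top)) λ z → 1≢0 (trans (sym A-lead) z)))
  Q-lead : coeff Q t ≡ + 1
  Q-lead = trans (sym A-top) (trans (cong (coeff A) m+t≡n) A-lead)

-- Divisibility and congruences

open CommutativeRing ℤ[X] using (*-commutativeSemigroup; semiring)
open SemiringDivisibility semiring
  using (_∣_; _,_; ∣-refl; ∣-trans; ∣-respˡ; ∣-respʳ; _∣0; 1∣_) renaming (x∣ʳy⇒x∣ʳzy to ∣-*ˡ)
open CommutativeSemigroupDivisibility *-commutativeSemigroup using (∙-cong-∣)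

∣-+ : ∀ {N p q} → N ∣ p → N ∣ q → N ∣ p +ₚ q
∣-+ {N} (U , UN≈p) (V , VN≈q) = U +ₚ V , ≈-trans (*ₚ-distribʳ N U V) (+ₚ-cong UN≈p VN≈q)

∣-neg : ∀ {N p} → N ∣ p → N ∣ -ₚ p
∣-neg {N} {p} (U , UN≈p) = -ₚ U , ≈-trans (neg-*ₚ U N) (-ₚ-cong UN≈p)
  where
  neg-*ₚ : ∀ U N → -ₚ U *ₚ N ≈ -ₚ (U *ₚ N)
  neg-*ₚ = solve-∀ ℤ[X]ᴬ

∣-*ʳ : ∀ {N p} q → N ∣ p → N ∣ p *ₚ q
∣-*ʳ {N} {p} q N∣p = ∣-respʳ (*ₚ-comm q p) (∣-*ˡ q N∣p)

infix 4 _≡_mod_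
record _≡_mod_ (p q N : Poly) : Set where
  constructor by-∣
  field ∣-difference : N ∣ p -ₚ q
open _≡_mod_

mod-refl : ∀ {N} p → p ≡ p mod N
mod-refl p = by-∣ (∣-respʳ (≈-sym (-ₚ-inverseʳ p)) (_ ∣0))

mod-+ : ∀ {N p p' q q'} → p ≡ p' mod N → q ≡ q' mod N → p +ₚ q ≡ p' +ₚ q' mod N
mod-+ {p = p} {p'} {q} {q'} (by-∣ p≡p') (by-∣ q≡q') = by-∣ (∣-respʳ (identity p p' q q') (∣-+ p≡p' q≡q'))
  where
  identity : ∀ p p' q q' → (p -ₚ p') +ₚ (q -ₚ q') ≈ (p +ₚ q) -ₚ (p' +ₚ q')
  identity = solve-∀ ℤ[X]ᴬ

mod-* : ∀ {N p p' q q'} → p ≡ p' mod N → q ≡ q' mod N → p *ₚ q ≡ p' *ₚ q' mod N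
mod-* {p = p} {p'} {q} {q'} (by-∣ p≡p') (by-∣ q≡q') =
  by-∣ (∣-respʳ (identity p p' q q') (∣-+ (∣-*ʳ q p≡p') (∣-*ˡ p' q≡q')))
  where
  identity : ∀ p p' q q' → (p -ₚ p') *ₚ q +ₚ p' *ₚ (q -ₚ q') ≈ p *ₚ q -ₚ p' *ₚ q'
  identity = solve-∀ ℤ[X]ᴬ

mod-resp-≈ : ∀ {N p p' q q'} → p ≈ p' → q ≈ q' → p ≡ q mod N → p' ≡ q' mod N
mod-resp-≈ p≈p' q≈q' (by-∣ p≡q) = by-∣ (∣-respʳ (+ₚ-cong p≈p' (-ₚ-cong q≈q')) p≡q)

∣-mod : ∀ {Ψ N p q} → Ψ ∣ N → p ≡ q mod N → Ψ ∣ q → Ψ ∣ p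
∣-mod {p = p} {q} Ψ∣N (by-∣ N∣p-q) Ψ∣q = ∣-respʳ (-ₚ-+ₚ-cancel p q) (∣-+ (∣-trans Ψ∣N N∣p-q) Ψ∣q)

-- X^n - 1 and geometric sums

Xpow-+ : ∀ a b → Xpow a *ₚ Xpow b ≈ Xpow (a ℕ.+ b)
Xpow-+ zero    b = *ₚ-identityˡ (Xpow b)
Xpow-+ (suc a) b = ≈-trans (X·-*ₚ (Xpow a) (Xpow b)) (X·-cong (Xpow-+ a b))

coeff-Xpow-≢ : ∀ n {j} → ¬ j ≡ n → coeff (Xpow n) j ≡ + 0
coeff-Xpow-≢ zero    {zero}  j≢n = contradiction refl j≢n
coeff-Xpow-≢ zero    {suc j} j≢n = refl
coeff-Xpow-≢ (suc n) {zero}  j≢n = refl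
coeff-Xpow-≢ (suc n) {suc j} j≢n = coeff-Xpow-≢ n (j≢n ∘ cong suc)

Xpow-monic : ∀ n → Monic (Xpow n) n
Xpow-monic n = record { leading = lead n ; above = λ j n<j → coeff-Xpow-≢ n (ℕ.>⇒≢ n<j) }
  where
  lead : ∀ n → coeff (Xpow n) n ≡ + 1
  lead zero    = refl
  lead (suc n) = lead n

Xⁿ-1 : ℕ → Poly
Xⁿ-1 n = Xpow n -ₚ oneₚ

Xⁿ-1-monic : ∀ n → Monic (Xⁿ-1 (suc n)) (suc n)
Xⁿ-1-monic n = record
  { leading = trans (coeff-+ Xⁿ⁺¹ (-ₚ oneₚ) (suc n)) (cong (_+ + 0) (Monic.leading (Xpow-monic (suc n))))
  ; above   = λ where
      (suc j) n<j → trans (coeff-+ Xⁿ⁺¹ (-ₚ oneₚ) (suc j))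
                          (cong (_+ + 0) (Monic.above (Xpow-monic (suc n)) (suc j) n<j)) }
  where Xⁿ⁺¹ = Xpow (suc n)

geom : ℕ → ℕ → Poly
geom a zero    = []
geom a (suc k) = oneₚ +ₚ Xpow a *ₚ geom a k

Xⁿ-1-*-geom : ∀ a k → Xⁿ-1 a *ₚ geom a k ≈ Xⁿ-1 (k ℕ.* a)
Xⁿ-1-*-geom a zero    = ≈-trans (*ₚ-zeroʳ (Xⁿ-1 a)) (≈-sym (-ₚ-inverseʳ oneₚ))
Xⁿ-1-*-geom a (suc k) = begin
  (Xpow a -ₚ oneₚ) *ₚ (oneₚ +ₚ Xpow a *ₚ geom a k)         ≈⟨ expand (Xpow a) (geom a k) ⟩
  Xpow a *ₚ ((Xpow a -ₚ oneₚ) *ₚ geom a k) +ₚ Xⁿ-1 a       ≈⟨ +ₚ-cong (*ₚ-congʳ (Xpow a) (Xⁿ-1-*-geom a k))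
                                                                        ≈-refl ⟩
  Xpow a *ₚ (Xpow (k ℕ.* a) -ₚ oneₚ) +ₚ (Xpow a -ₚ oneₚ)   ≈⟨ collect (Xpow a) (Xpow (k ℕ.* a)) ⟩
  Xpow a *ₚ Xpow (k ℕ.* a) -ₚ oneₚ                         ≈⟨ +ₚ-cong (Xpow-+ a (k ℕ.* a)) ≈-refl ⟩
  Xⁿ-1 (suc k ℕ.* a)                                       ∎
  where
  open ≈-Reasoning
  expand : ∀ x g → (x -ₚ oneₚ) *ₚ (oneₚ +ₚ x *ₚ g) ≈ x *ₚ ((x -ₚ oneₚ) *ₚ g) +ₚ (x -ₚ oneₚ)
  expand = solve-∀ ℤ[X]ᴬ
  collect : ∀ x y → x *ₚ (y -ₚ oneₚ) +ₚ (x -ₚ oneₚ) ≈ x *ₚ y -ₚ oneₚ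
  collect = solve-∀ ℤ[X]ᴬ

Xⁿ-1-∣ : ∀ {d n} → d ℕ.∣ n → Xⁿ-1 d ∣ Xⁿ-1 n
Xⁿ-1-∣ {d} (ℕ.divides k refl) = geom d k , ≈-trans (*ₚ-comm (geom d k) (Xⁿ-1 d)) (Xⁿ-1-*-geom d k)

geom-1-∣-Xⁿ-1 : ∀ n → geom 1 n ∣ Xⁿ-1 n
geom-1-∣-Xⁿ-1 n = Xⁿ-1 1 , ≈-trans (Xⁿ-1-*-geom 1 n) (≈-reflexive (cong Xⁿ-1 (ℕ.*-identityʳ n)))

geom-mod : ∀ {N} a b → Xpow a ≡ Xpow b mod N → ∀ k → geom a k ≡ geom b k mod N
geom-mod a b Xᵃ≡Xᵇ zero    = mod-refl []
geom-mod a b Xᵃ≡Xᵇ (suc k) = mod-+ (mod-refl oneₚ) (mod-* Xᵃ≡Xᵇ (geom-mod a b Xᵃ≡Xᵇ k))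

geom-zero : ∀ k → geom 0 k ≈ + k ∷ []
geom-zero zero    = []≈0∷[]
geom-zero (suc k) = +ₚ-cong {oneₚ} ≈-refl (≈-trans (*ₚ-identityˡ (geom 0 k)) (geom-zero k))

Xpow-mod-Xⁿ-1 : ∀ M n r → Xpow (r ℕ.+ M ℕ.* n) ≡ Xpow r mod Xⁿ-1 n
Xpow-mod-Xⁿ-1 M n r = mod-resp-≈ (Xpow-+ r (M ℕ.* n)) (*ₚ-identityʳ (Xpow r))
  (mod-* (mod-refl (Xpow r)) (by-∣ (Xⁿ-1-∣ (ℕ.divides M refl))))

-- Content and coprimality over ℚ

const : ℤ → Poly
const a = a ∷ []

·ₚ≈const-*ₚ : ∀ a p → a ·ₚ p ≈ const a *ₚ p
·ₚ≈const-*ₚ a p = ≈-sym (≈-trans (+ₚ-cong ≈-refl X·[]) (+ₚ-identityʳ (a ·ₚ p)))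

const-* : ∀ a b → const (a * b) ≈ const a *ₚ const b
const-* a b = ∷-cong (sym (ℤ.+-identityʳ (a * b))) ≈-refl

coeff-const-*ₚ : ∀ a p i → coeff (const a *ₚ p) i ≡ a * coeff p i
coeff-const-*ₚ a p i = trans (sym (coeff-≡ (·ₚ≈const-*ₚ a p) i)) (coeff-· a p i)

leadingTerm : Poly → ℕ → Poly
leadingTerm p t = const (coeff p t) *ₚ Xpow t

peel-leadingTerm : ∀ p {t} → DegreeBelow p (suc t) → DegreeBelow (p -ₚ leadingTerm p t) t
peel-leadingTerm p {t} bound j t≤j = begin
  coeff (p -ₚ leadingTerm p t) j       ≡⟨ coeff-+ p _ j ⟩
  coeff p j + coeff (-ₚ leadingTerm p t) j ≡⟨ cong (_+_ (coeff p j)) (trans (coeff-neg (leadingTerm p t) j)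
                                                 (cong -_ (coeff-const-*ₚ (coeff p t) (Xpow t) j))) ⟩
  coeff p j - coeff p t * coeff (Xpow t) j ≡⟨ vanish (ℕ.m≤n⇒m<n∨m≡n t≤j) ⟩
  + 0                                  ∎
  where
  open ≡-Reasoning
  vanish : t < j ⊎ t ≡ j → coeff p j - coeff p t * coeff (Xpow t) j ≡ + 0
  vanish (inj₁ t<j)  = cong₂ _-_ (bound j t<j)
    (trans (cong (_*_ (coeff p t)) (Monic.above (Xpow-monic t) j t<j)) (ℤ.*-zeroʳ (coeff p t)))
  vanish (inj₂ refl) = trans
    (cong (_-_ (coeff p t)) (trans (cong (_*_ (coeff p t)) (Monic.leading (Xpow-monic t))) (ℤ.*-identityʳ _)))
    (ℤ.+-inverseʳ (coeff p t))

-- Peel off the leading term of W: as M is monic, it is a coefficient of c · C.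
monic-*ₚ-content : ∀ {M m} c → Monic M m → ∀ b {W C} → DegreeBelow W b →
  M *ₚ W ≈ const c *ₚ C → ∃ λ W' → W ≈ const c *ₚ W'
monic-*ₚ-content c M-monic zero    {W} bound MW≈cC =
  [] , pointwise λ j → trans (bound j z≤n) (sym (coeff-≡ (*ₚ-zeroʳ (const c)) j))
monic-*ₚ-content {M} {m} c M-monic (suc t) {W} {C} bound MW≈cC = W₁' +ₚ const w₁ *ₚ Xpow t , W≈
  where
  w₁ = coeff C (m ℕ.+ t)
  W₁ = W -ₚ leadingTerm W t
  lead≈ : leadingTerm W t ≈ const c *ₚ (const w₁ *ₚ Xpow t)
  lead≈ = begin
    const (coeff W t) *ₚ Xpow t        ≈⟨ *ₚ-congˡ (Xpow t) (≈-reflexive (cong const (trans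
                                            (sym (proj₁ (monic-*ₚ-lead W t M-monic bound)))
                                            (trans (coeff-≡ MW≈cC (m ℕ.+ t)) (coeff-const-*ₚ c C (m ℕ.+ t)))))) ⟩
    const (c * w₁) *ₚ Xpow t            ≈⟨ *ₚ-congˡ (Xpow t) (const-* c w₁) ⟩
    (const c *ₚ const w₁) *ₚ Xpow t     ≈⟨ *ₚ-assoc (const c) (const w₁) (Xpow t) ⟩
    const c *ₚ (const w₁ *ₚ Xpow t)     ∎
    where open ≈-Reasoning
  ih = monic-*ₚ-content c M-monic t {W₁} {C -ₚ M *ₚ (const w₁ *ₚ Xpow t)} (peel-leadingTerm W bound) (begin
    M *ₚ (W -ₚ leadingTerm W t)                    ≈⟨ *ₚ-distrib-- M W _ ⟩
    M *ₚ W -ₚ M *ₚ leadingTerm W t                 ≈⟨ +ₚ-cong MW≈cC (-ₚ-cong (*ₚ-congʳ M lead≈)) ⟩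
    const c *ₚ C -ₚ M *ₚ (const c *ₚ (const w₁ *ₚ Xpow t)) ≈⟨ factor M C (const c) _ ⟩
    const c *ₚ (C -ₚ M *ₚ (const w₁ *ₚ Xpow t))    ∎)
    where
    open ≈-Reasoning
    factor : ∀ M C k T → k *ₚ C -ₚ M *ₚ (k *ₚ T) ≈ k *ₚ (C -ₚ M *ₚ T)
    factor = solve-∀ ℤ[X]ᴬ
  W₁' = proj₁ ih
  W≈ : W ≈ const c *ₚ (W₁' +ₚ const w₁ *ₚ Xpow t)
  W≈ = begin
    W                                              ≈⟨ ≈-sym (-ₚ-+ₚ-cancel W _) ⟩
    (W -ₚ leadingTerm W t) +ₚ leadingTerm W t      ≈⟨ +ₚ-cong (proj₂ ih) lead≈ ⟩
    const c *ₚ W₁' +ₚ const c *ₚ (const w₁ *ₚ Xpow t) ≈⟨ ≈-sym (*ₚ-distribˡ (const c) W₁' _) ⟩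
    const c *ₚ (W₁' +ₚ const w₁ *ₚ Xpow t)         ∎
    where open ≈-Reasoning

monic-*ₚ-cancel-scalar : ∀ {M m W C} c → Monic M m → M *ₚ W ≈ const (+ suc c) *ₚ C → M ∣ C
monic-*ₚ-cancel-scalar {M} {m} {W} {C} c M-monic MW≈kC = W' , pointwise λ i → ℤ.*-cancelˡ-≡ k _ _
  (trans (sym (coeff-const-*ₚ k (W' *ₚ M) i)) (trans (coeff-≡ kW'M≈kC i) (coeff-const-*ₚ k C i)))
  where
  k = + suc c
  content = monic-*ₚ-content k M-monic (length W) (degreeBelow-length W) MW≈kC
  W' = proj₁ content
  W≈kW' = proj₂ content
  kW'M≈kC : const k *ₚ (W' *ₚ M) ≈ const k *ₚ C
  kW'M≈kC = begin
    const k *ₚ (W' *ₚ M)   ≈⟨ rearrange (const k) W' M ⟩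
    M *ₚ (const k *ₚ W')   ≈⟨ *ₚ-congʳ M (≈-sym W≈kW') ⟩
    M *ₚ W                 ≈⟨ MW≈kC ⟩
    const k *ₚ C           ∎
    where
    open ≈-Reasoning
    rearrange : ∀ k w m → k *ₚ (w *ₚ m) ≈ m *ₚ (k *ₚ w)
    rearrange = solve-∀ ℤ[X]ᴬ

infix 4 _∈⟨_,_⟩
record _∈⟨_,_⟩ (p M N : Poly) : Set where
  constructor combination
  field
    U V      : Poly
    equality : U *ₚ M +ₚ V *ₚ N ≈ p

∈-resp-≈ : ∀ {p q M N} → p ≈ q → p ∈⟨ M , N ⟩ → q ∈⟨ M , N ⟩
∈-resp-≈ p≈q (combination U V e) = combination U V (≈-trans e p≈q)

∈-- : ∀ {p q M N} → p ∈⟨ M , N ⟩ → q ∈⟨ M , N ⟩ → p -ₚ q ∈⟨ M , N ⟩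
∈-- {M = M} {N} (combination U V e) (combination U' V' e') =
  combination (U -ₚ U') (V -ₚ V') (≈-trans (regroup U V U' V' M N) (+ₚ-cong e (-ₚ-cong e')))
  where
  regroup : ∀ U V U' V' M N →
    (U -ₚ U') *ₚ M +ₚ (V -ₚ V') *ₚ N ≈ (U *ₚ M +ₚ V *ₚ N) -ₚ (U' *ₚ M +ₚ V' *ₚ N)
  regroup = solve-∀ ℤ[X]ᴬ

∈-*ˡ : ∀ {p M N} q → p ∈⟨ M , N ⟩ → q *ₚ p ∈⟨ M , N ⟩
∈-*ˡ {M = M} {N} q (combination U V e) =
  combination (q *ₚ U) (q *ₚ V) (≈-trans (regroup q U V M N) (*ₚ-congʳ q e))
  where
  regroup : ∀ q U V M N → q *ₚ U *ₚ M +ₚ q *ₚ V *ₚ N ≈ q *ₚ (U *ₚ M +ₚ V *ₚ N)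
  regroup = solve-∀ ℤ[X]ᴬ

∣-∈ : ∀ {p N M M'} → N ∣ p → N ∈⟨ M , M' ⟩ → p ∈⟨ M , M' ⟩
∣-∈ (W , WN≈p) N∈ = ∈-resp-≈ WN≈p (∈-*ˡ W N∈)

∣⇒∈ˡ : ∀ {p M} N → M ∣ p → p ∈⟨ M , N ⟩
∣⇒∈ˡ N (U , UM≈p) = combination U [] (≈-trans (+ₚ-identityʳ _) UM≈p)

∣⇒∈ʳ : ∀ {p N} M → N ∣ p → p ∈⟨ M , N ⟩
∣⇒∈ʳ M (V , VN≈p) = combination [] V VN≈p

∈-divisors : ∀ {p M N M' N'} → M' ∣ M → N' ∣ N → p ∈⟨ M , N ⟩ → p ∈⟨ M' , N' ⟩
∈-divisors {M' = M'} {N'} (R , RM'≈M) (S , SN'≈N) (combination U V e) =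
  combination (U *ₚ R) (V *ₚ S)
    (≈-trans (regroup U R M' V S N') (≈-trans (+ₚ-cong (*ₚ-congʳ U RM'≈M) (*ₚ-congʳ V SN'≈N)) e))
  where
  regroup : ∀ U R M' V S N' → U *ₚ R *ₚ M' +ₚ V *ₚ S *ₚ N' ≈ U *ₚ (R *ₚ M') +ₚ V *ₚ (S *ₚ N')
  regroup = solve-∀ ℤ[X]ᴬ

-- Coprimality in ℚ[X], witnessed inside ℤ[X] by a positive integer in the ideal.
CoprimeOverℚ : Poly → Poly → Set
CoprimeOverℚ M N = ∃ λ c → const (+ suc c) ∈⟨ M , N ⟩

coprime-oneʳ : ∀ M → CoprimeOverℚ M oneₚ
coprime-oneʳ M = 0 , ∣⇒∈ʳ M ∣-refl

coprime-respʳ : ∀ {M N N'} → N ≈ N' → CoprimeOverℚ M N → CoprimeOverℚ M N'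
coprime-respʳ N≈N' (c , c∈) = c , ∈-divisors ∣-refl (∣-respʳ (≈-sym N≈N') ∣-refl) c∈

coprime-*ʳ : ∀ {M N₁ N₂} → CoprimeOverℚ M N₁ → CoprimeOverℚ M N₂ → CoprimeOverℚ M (N₁ *ₚ N₂)
coprime-*ʳ {M} {N₁} {N₂} (c₁ , combination U₁ V₁ e₁) (c₂ , combination U₂ V₂ e₂) =
  c₂ ℕ.+ c₁ ℕ.* suc c₂ ,
  combination (U₁ *ₚ (U₂ *ₚ M +ₚ V₂ *ₚ N₂) +ₚ V₁ *ₚ N₁ *ₚ U₂) (V₁ *ₚ V₂) (begin
    (U₁ *ₚ (U₂ *ₚ M +ₚ V₂ *ₚ N₂) +ₚ V₁ *ₚ N₁ *ₚ U₂) *ₚ M +ₚ V₁ *ₚ V₂ *ₚ (N₁ *ₚ N₂)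
      ≈⟨ expand M N₁ N₂ U₁ V₁ U₂ V₂ ⟩
    (U₁ *ₚ M +ₚ V₁ *ₚ N₁) *ₚ (U₂ *ₚ M +ₚ V₂ *ₚ N₂)   ≈⟨ *ₚ-cong e₁ e₂ ⟩
    const (+ suc c₁) *ₚ const (+ suc c₂)             ≈⟨ ≈-sym (const-* (+ suc c₁) (+ suc c₂)) ⟩
    const (+ suc c₁ * + suc c₂)                      ∎)
  where
  open ≈-Reasoning
  expand : ∀ M N₁ N₂ U₁ V₁ U₂ V₂ →
    (U₁ *ₚ (U₂ *ₚ M +ₚ V₂ *ₚ N₂) +ₚ V₁ *ₚ N₁ *ₚ U₂) *ₚ M +ₚ V₁ *ₚ V₂ *ₚ (N₁ *ₚ N₂)
      ≈ (U₁ *ₚ M +ₚ V₁ *ₚ N₁) *ₚ (U₂ *ₚ M +ₚ V₂ *ₚ N₂)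
  expand = solve-∀ ℤ[X]ᴬ

-- c · C = (U M + V N) C is a multiple of M N once M ∣ C and N ∣ C.
coprime-∣-*ₚ : ∀ {M N C δ} → CoprimeOverℚ M N → Monic (M *ₚ N) δ → M ∣ C → N ∣ C → M *ₚ N ∣ C
coprime-∣-*ₚ {M} {N} {C} (c , combination U V e) MN-monic (R , RM≈C) (S , SN≈C) =
  monic-*ₚ-cancel-scalar c MN-monic (begin
    M *ₚ N *ₚ (U *ₚ S +ₚ V *ₚ R)           ≈⟨ regroup M N U V R S ⟩
    U *ₚ M *ₚ (S *ₚ N) +ₚ V *ₚ N *ₚ (R *ₚ M) ≈⟨ +ₚ-cong (*ₚ-congʳ (U *ₚ M) SN≈C)
                                                            (*ₚ-congʳ (V *ₚ N) RM≈C) ⟩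
    U *ₚ M *ₚ C +ₚ V *ₚ N *ₚ C             ≈⟨ ≈-sym (*ₚ-distribʳ C (U *ₚ M) (V *ₚ N)) ⟩
    (U *ₚ M +ₚ V *ₚ N) *ₚ C               ≈⟨ *ₚ-congˡ C e ⟩
    const (+ suc c) *ₚ C                  ∎)
  where
  open ≈-Reasoning
  regroup : ∀ M N U V R S → M *ₚ N *ₚ (U *ₚ S +ₚ V *ₚ R) ≈ U *ₚ M *ₚ (S *ₚ N) +ₚ V *ₚ N *ₚ (R *ₚ M)
  regroup = solve-∀ ℤ[X]ᴬ

-- Exactness of long division

normalize-≈ : ∀ p → normalize p ≈ p
normalize-≈ []      = ≈-refl
normalize-≈ (a ∷ p) with normalize p | normalize-≈ p
... | b ∷ q | q≈p = ∷-cong refl q≈p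
... | []    | []≈p with a ℤ.≟ + 0
...   | yes refl = ≈-trans []≈0∷[] (∷-cong refl []≈p)
...   | no  _    = ∷-cong refl []≈p

data Trimmed : Poly → Set where
  []  : Trimmed []
  last≢0 : ∀ x a → ¬ lastOr x a ≡ + 0 → Trimmed (x ∷ a)

normalize-trimmed : ∀ p → Trimmed (normalize p)
normalize-trimmed []      = []
normalize-trimmed (a ∷ p) with normalize p | normalize-trimmed p
... | b ∷ q | last≢0 .b .q nz = last≢0 a (b ∷ q) nz
... | []    | []  with a ℤ.≟ + 0
...   | yes _   = []
...   | no  a≢0 = last≢0 a [] a≢0

coeff-lastOr : ∀ x a → coeff (x ∷ a) (length a) ≡ lastOr x a
coeff-lastOr x []      = refl
coeff-lastOr x (y ∷ a) = coeff-lastOr y a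

degreeBelow-∷ : ∀ x a → DegreeBelow (x ∷ a) (suc (length a))
degreeBelow-∷ x a = degreeBelow-length (x ∷ a)

normalize-≈[] : ∀ {p} → p ≈ [] → normalize p ≡ []
normalize-≈[] {p} p≈[] with normalize p | normalize-trimmed p | normalize-≈ p
... | []    | []         | _  = refl
... | x ∷ a | last≢0 .x .a nz | e =
  contradiction (trans (sym (coeff-lastOr x a)) (trans (coeff-≡ e (length a)) (coeff-≡ p≈[] (length a)))) nz

record NormalizesWithDegree (p : Poly) (d : ℕ) : Set where
  field
    head   : ℤ
    tail   : Poly
    normal : normalize p ≡ head ∷ tail
    degree≡ : length tail ≡ d

normalize-degree : ∀ p {d} → ¬ coeff p d ≡ + 0 → DegreeBelow p (suc d) → NormalizesWithDegree p d
normalize-degree p {d} nz bound with normalize p in eq | normalize-trimmed p | normalize-≈ p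
... | []    | []               | e = contradiction (sym (coeff-≡ e d)) nz
... | x ∷ a | last≢0 .x .a nz' | e = record { head = x ; tail = a ; normal = eq ; degree≡ = ℕ.≤-antisym
  (ℕ.≤-pred (nonzero⇒<degreeBound p bound λ z → nz' (trans (sym (coeff-lastOr x a)) (trans (coeff-≡ e (length a)) z))))
  (ℕ.≤-pred (nonzero⇒<degreeBound (x ∷ a) (degreeBelow-∷ x a) λ z → nz (trans (sym (coeff-≡ e d)) z))) }

monomial≈const-*ₚ-Xpow : ∀ t c → replicate t (+ 0) ++ c ∷ [] ≈ const c *ₚ Xpow t
monomial≈const-*ₚ-Xpow t c = ≈-trans (monomial≈· t) (·ₚ≈const-*ₚ c (Xpow t))
  where
  monomial≈· : ∀ t → replicate t (+ 0) ++ c ∷ [] ≈ c ·ₚ Xpow t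
  monomial≈· zero    = ∷-cong (sym (ℤ.*-identityʳ c)) ≈-refl
  monomial≈· (suc t) = ∷-cong (sym (ℤ.*-zeroʳ c)) (monomial≈· t)

m+n≮ᵇm : ∀ m n → (m ℕ.+ n ℕ.<ᵇ m) ≡ false
m+n≮ᵇm zero    n = refl
m+n≮ᵇm (suc m) n = m+n≮ᵇm m n

divMonic-step : ∀ f A B {x a y b m t} → normalize A ≡ x ∷ a → normalize B ≡ y ∷ b →
  length a ≡ m ℕ.+ t → length b ≡ m →
  divMonic (suc f) A B ≡
    (let T = replicate t (+ 0) ++ lastOr x a ∷ [] in T +ₚ divMonic f ((x ∷ a) -ₚ T *ₚ (y ∷ b)) (y ∷ b))
divMonic-step f A B {m = m} {t} nA nB la lb rewrite nA | nB | la | lb | ℕ.m+n∸m≡n m t | m+n≮ᵇm m t = refl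

degreeBelow-mono : ∀ p {b c} → b ≤ c → DegreeBelow p b → DegreeBelow p c
degreeBelow-mono p b≤c bound j c≤j = bound j (ℕ.≤-trans b≤c c≤j)

divMonic-exact : ∀ f {A B Q m} → Monic B m → B *ₚ Q ≈ A → DegreeBelow Q f → divMonic f A B ≈ Q
divMonic-exact zero    {Q = Q} _ _ bound = pointwise λ j → sym (bound j z≤n)
divMonic-exact (suc f) {A} {B} {Q} {m} B-monic BQ≈A bound with degreeView Q
... | zero-poly Q≈[]
  rewrite normalize-≈[] (≈-trans (≈-sym BQ≈A) (≈-trans (*ₚ-congʳ B Q≈[]) (*ₚ-zeroʳ B))) = ≈-sym Q≈[]
... | of-degree t nz Q-bound = begin
  divMonic (suc f) A B
    ≡⟨ divMonic-step f A B (normal A-normal) (normal B-normal) (degree≡ A-normal) (degree≡ B-normal) ⟩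
  T +ₚ divMonic f ((x ∷ a) -ₚ T *ₚ (y ∷ b)) (y ∷ b)
    ≈⟨ +ₚ-cong T≈lead (divMonic-exact f (monic-resp-≈ (≈-sym y∷b≈B) B-monic) remainder-eq
                        (degreeBelow-mono (Q -ₚ leadingTerm Q t) t≤f (peel-leadingTerm Q Q-bound))) ⟩
  leadingTerm Q t +ₚ (Q -ₚ leadingTerm Q t)            ≈⟨ +ₚ-comm (leadingTerm Q t) _ ⟩
  (Q -ₚ leadingTerm Q t) +ₚ leadingTerm Q t            ≈⟨ -ₚ-+ₚ-cancel Q (leadingTerm Q t) ⟩
  Q                                                    ∎
  where
  open ≈-Reasoning
  open NormalizesWithDegree
  top = monic-*ₚ-lead Q t B-monic Q-bound
  A-top : coeff A (m ℕ.+ t) ≡ coeff Q t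
  A-top = trans (sym (coeff-≡ BQ≈A (m ℕ.+ t))) (proj₁ top)
  A-normal = normalize-degree A (λ z → nz (trans (sym A-top) z)) (degreeBelow-resp-≈ BQ≈A (proj₂ top))
  B-normal = normalize-degree B (λ z → 1≢0 (trans (sym (Monic.leading B-monic)) z)) (Monic.above B-monic)
  x = head A-normal
  a = tail A-normal
  y = head B-normal
  b = tail B-normal
  T = replicate t (+ 0) ++ lastOr x a ∷ []
  x∷a≈A : x ∷ a ≈ A
  x∷a≈A = subst (_≈ A) (normal A-normal) (normalize-≈ A)
  y∷b≈B : y ∷ b ≈ B
  y∷b≈B = subst (_≈ B) (normal B-normal) (normalize-≈ B)
  T≈lead : T ≈ leadingTerm Q t
  T≈lead = ≈-trans (monomial≈const-*ₚ-Xpow t (lastOr x a)) (*ₚ-congˡ (Xpow t) (≈-reflexive (cong const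
    (trans (sym (coeff-lastOr x a)) (trans (coeff-≡ x∷a≈A (length a)) (trans (cong (coeff A) (degree≡ A-normal)) A-top))))))
  t≤f : t ≤ f
  t≤f = ℕ.≤-pred (nonzero⇒<degreeBound Q bound nz)
  remainder-eq : (y ∷ b) *ₚ (Q -ₚ leadingTerm Q t) ≈ (x ∷ a) -ₚ T *ₚ (y ∷ b)
  remainder-eq = begin
    (y ∷ b) *ₚ (Q -ₚ leadingTerm Q t)            ≈⟨ *ₚ-distrib-- (y ∷ b) Q _ ⟩
    (y ∷ b) *ₚ Q -ₚ (y ∷ b) *ₚ leadingTerm Q t   ≈⟨ +ₚ-cong (≈-trans (*ₚ-congˡ Q y∷b≈B) (≈-trans BQ≈A (≈-sym x∷a≈A)))
                                                      (-ₚ-cong (≈-trans (*ₚ-comm (y ∷ b) _) (*ₚ-congˡ (y ∷ b) (≈-sym T≈lead)))) ⟩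
    (x ∷ a) -ₚ T *ₚ (y ∷ b)                      ∎

-- Cyclotomic polynomials

fuel : ℕ → ℕ
fuel n = suc (length (Xⁿ-1 n))

-- cycloList divides X^(k+1) - 1 by the product of the earlier Φ_d, d ∣ k+1, computed by a
-- helper local to cycloList.  The meta earlierDivisorProduct is that product, solved by
-- unification in the one case of capture where the helper reduces on a list variable.
mutual
  earlierDivisorProduct : ℕ → List (ℕ × Poly) → Poly
  earlierDivisorProduct = _

  private
    capture : ∀ k → cycloList (suc k) ≡ cycloList (suc k) → ⊤
    capture k e with cycloList k
    ... | [] = tt
    ... | (d , φ) ∷ xs with d ℕ.∣? suc k
    ...   | no  _ = tt
    ...   | yes _ = tt
      where
      L = ((d , φ) ∷ xs) ++ (suc k , divMonic (fuel (suc k)) (Xⁿ-1 (suc k)) (φ *ₚ earlierDivisorProduct k xs)) ∷ []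
      unify : L ≡ L
      unify = e

lastPair-∷ʳ : ∀ (L : List (ℕ × Poly)) x → lastPair (L ++ x ∷ []) ≡ proj₂ x
lastPair-∷ʳ []          x = refl
lastPair-∷ʳ (y ∷ [])    x = refl
lastPair-∷ʳ (y ∷ z ∷ L) x = lastPair-∷ʳ (z ∷ L) x

graph : ℕ → ℕ × Poly
graph d = d , cyclotomic d

cycloList-graph : ∀ k → cycloList k ≡ map graph (applyUpTo suc k)
cycloList-graph zero    = refl
cycloList-graph (suc k) = begin
  cycloList k ++ (suc k , _) ∷ []
    ≡⟨ cong₂ (λ L φ → L ++ (suc k , φ) ∷ []) (cycloList-graph k) (sym (lastPair-∷ʳ (cycloList k) _)) ⟩
  map graph (applyUpTo suc k) ++ graph (suc k) ∷ []
    ≡⟨ sym (List.map-++ graph (applyUpTo suc k) (suc k ∷ [])) ⟩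
  map graph (applyUpTo suc k ++ suc k ∷ [])
    ≡⟨ cong (map graph) (List.applyUpTo-∷ʳ suc k) ⟩
  map graph (applyUpTo suc (suc k)) ∎
  where open ≡-Reasoning

earlierDivisorProduct-graph : ∀ k ds →
  earlierDivisorProduct k (map graph ds) ≡ productₚ (map cyclotomic (filter (ℕ._∣? suc k) ds))
earlierDivisorProduct-graph k []       = refl
earlierDivisorProduct-graph k (d ∷ ds) with d ℕ.∣? suc k
... | yes _ = cong (cyclotomic d *ₚ_) (earlierDivisorProduct-graph k ds)
... | no  _ = earlierDivisorProduct-graph k ds

divisorProduct : ℕ → ℕ → Poly
divisorProduct n m = productₚ (map cyclotomic (filter (ℕ._∣? n) (applyUpTo suc m)))

cyclotomic-suc : ∀ k → cyclotomic (suc k) ≡ divMonic (fuel (suc k)) (Xⁿ-1 (suc k)) (divisorProduct (suc k) k)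
cyclotomic-suc k = begin
  cyclotomic (suc k)                                   ≡⟨ lastPair-∷ʳ (cycloList k) _ ⟩
  divide (earlierDivisorProduct k (cycloList k))       ≡⟨ cong (divide ∘ earlierDivisorProduct k) (cycloList-graph k) ⟩
  divide (earlierDivisorProduct k (map graph (applyUpTo suc k)))
                                                       ≡⟨ cong divide (earlierDivisorProduct-graph k (applyUpTo suc k)) ⟩
  divide (divisorProduct (suc k) k)                    ∎
  where
  open ≡-Reasoning
  divide = divMonic (fuel (suc k)) (Xⁿ-1 (suc k))

productₚ-++ : ∀ ps qs → productₚ (ps ++ qs) ≈ productₚ ps *ₚ productₚ qs
productₚ-++ []       qs = ≈-sym (*ₚ-identityˡ _)
productₚ-++ (p ∷ ps) qs = ≈-trans (*ₚ-congʳ p (productₚ-++ ps qs)) (≈-sym (*ₚ-assoc p (productₚ ps) (productₚ qs)))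

divisorProduct-suc : ∀ n m →
  divisorProduct n (suc m) ≈ divisorProduct n m *ₚ productₚ (map cyclotomic (filter (ℕ._∣? n) (suc m ∷ [])))
divisorProduct-suc n m = begin
  divisorProduct n (suc m)                  ≡⟨ cong (Φs ∘ filter (ℕ._∣? n)) (sym (List.applyUpTo-∷ʳ suc m)) ⟩
  Φs (filter (ℕ._∣? n) (ds ++ suc m ∷ []))  ≡⟨ cong Φs (List.filter-++ (ℕ._∣? n) ds (suc m ∷ [])) ⟩
  Φs (filter (ℕ._∣? n) ds ++ last)          ≡⟨ cong productₚ (List.map-++ cyclotomic (filter (ℕ._∣? n) ds) last) ⟩
  productₚ (map cyclotomic (filter (ℕ._∣? n) ds) ++ map cyclotomic last)
                                            ≈⟨ productₚ-++ (map cyclotomic (filter (ℕ._∣? n) ds)) _ ⟩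
  divisorProduct n m *ₚ Φs last             ∎
  where
  open ≈-Reasoning
  Φs = productₚ ∘ map cyclotomic
  ds = applyUpTo suc m
  last = filter (ℕ._∣? n) (suc m ∷ [])

divisorProduct-suc-∣ : ∀ {n m} → suc m ℕ.∣ n → divisorProduct n (suc m) ≈ divisorProduct n m *ₚ cyclotomic (suc m)
divisorProduct-suc-∣ {n} {m} m+1∣n = ≈-trans (divisorProduct-suc n m) (*ₚ-congʳ (divisorProduct n m)
  (≈-trans (≈-reflexive (cong (productₚ ∘ map cyclotomic) (List.filter-accept (ℕ._∣? n) m+1∣n)))
           (*ₚ-identityʳ (cyclotomic (suc m)))))

divisorProduct-suc-∤ : ∀ {n m} → ¬ suc m ℕ.∣ n → divisorProduct n (suc m) ≈ divisorProduct n m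
divisorProduct-suc-∤ {n} {m} m+1∤n = ≈-trans (divisorProduct-suc n m) (≈-trans (*ₚ-congʳ (divisorProduct n m)
  (≈-reflexive (cong (productₚ ∘ map cyclotomic) (List.filter-reject (ℕ._∣? n) m+1∤n))))
  (*ₚ-identityʳ (divisorProduct n m)))

divisorProduct-∣ : ∀ {g n} → g ℕ.∣ n → ∀ m → divisorProduct g m ∣ divisorProduct n m
divisorProduct-∣ g∣n zero = ∣-refl
divisorProduct-∣ {g} {n} g∣n (suc m) with suc m ℕ.∣? g | suc m ℕ.∣? n
... | yes d∣g | yes d∣n = ∣-respˡ (≈-sym (divisorProduct-suc-∣ d∣g)) (∣-respʳ (≈-sym (divisorProduct-suc-∣ d∣n))
                            (∙-cong-∣ (divisorProduct-∣ g∣n m) ∣-refl))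
... | yes d∣g | no  d∤n = contradiction (ℕ.∣-trans d∣g g∣n) d∤n
... | no  d∤g | yes d∣n = ∣-respˡ (≈-sym (divisorProduct-suc-∤ d∤g)) (∣-respʳ (≈-sym (divisorProduct-suc-∣ d∣n))
                            (∣-*ʳ (cyclotomic (suc m)) (divisorProduct-∣ g∣n m)))
... | no  d∤g | no  d∤n = ∣-respˡ (≈-sym (divisorProduct-suc-∤ d∤g)) (∣-respʳ (≈-sym (divisorProduct-suc-∤ d∤n))
                            (divisorProduct-∣ g∣n m))

divisorProduct-beyond : ∀ g {m} → suc g ≤ m → divisorProduct (suc g) m ≈ divisorProduct (suc g) (suc g)
divisorProduct-beyond g {suc m} g<m+1 with ℕ.m≤n⇒m<n∨m≡n g<m+1
... | inj₂ refl     = ≈-refl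
... | inj₁ (s≤s g<m) = ≈-trans (divisorProduct-suc-∤ (λ m+1∣g → ℕ.<⇒≱ (s≤s g<m) (ℕ.∣⇒≤ m+1∣g)))
                              (divisorProduct-beyond g g<m)

∈-swap : ∀ {p M N} → p ∈⟨ M , N ⟩ → p ∈⟨ N , M ⟩
∈-swap {M = M} {N} (combination U V e) = combination V U (≈-trans (+ₚ-comm (V *ₚ N) (U *ₚ M)) e)

Xⁿ-1-bezout : ∀ {d a b} u v → d ℕ.+ u ℕ.* a ≡ v ℕ.* b → Xⁿ-1 d ∈⟨ Xⁿ-1 b , Xⁿ-1 a ⟩
Xⁿ-1-bezout {d} {a} {b} u v eq = combination (geom b v) (-ₚ (Xpow d *ₚ geom a u)) (begin
  geom b v *ₚ Xⁿ-1 b +ₚ -ₚ (Xpow d *ₚ geom a u) *ₚ Xⁿ-1 a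
    ≈⟨ regroup (geom b v) (Xⁿ-1 b) (Xpow d) (geom a u) (Xⁿ-1 a) ⟩
  Xⁿ-1 b *ₚ geom b v -ₚ Xpow d *ₚ (Xⁿ-1 a *ₚ geom a u)
    ≈⟨ +ₚ-cong (Xⁿ-1-*-geom b v) (-ₚ-cong (*ₚ-congʳ (Xpow d) (Xⁿ-1-*-geom a u))) ⟩
  Xⁿ-1 (v ℕ.* b) -ₚ Xpow d *ₚ Xⁿ-1 (u ℕ.* a)
    ≈⟨ expand (Xpow (v ℕ.* b)) (Xpow d) (Xpow (u ℕ.* a)) ⟩
  (Xpow (v ℕ.* b) -ₚ Xpow d *ₚ Xpow (u ℕ.* a)) +ₚ Xⁿ-1 d
    ≈⟨ +ₚ-cong (+ₚ-cong (≈-refl {Xpow (v ℕ.* b)}) (-ₚ-cong Xᵈ⁺ᵘᵃ≈Xᵛᵇ)) (≈-refl {Xⁿ-1 d}) ⟩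
  (Xpow (v ℕ.* b) -ₚ Xpow (v ℕ.* b)) +ₚ Xⁿ-1 d
    ≈⟨ +ₚ-cong (-ₚ-inverseʳ (Xpow (v ℕ.* b))) (≈-refl {Xⁿ-1 d}) ⟩
  Xⁿ-1 d ∎)
  where
  open ≈-Reasoning
  Xᵈ⁺ᵘᵃ≈Xᵛᵇ : Xpow d *ₚ Xpow (u ℕ.* a) ≈ Xpow (v ℕ.* b)
  Xᵈ⁺ᵘᵃ≈Xᵛᵇ = ≈-trans (Xpow-+ d (u ℕ.* a)) (≈-reflexive (cong Xpow eq))
  regroup : ∀ G B Y H A → G *ₚ B +ₚ -ₚ (Y *ₚ H) *ₚ A ≈ B *ₚ G -ₚ Y *ₚ (A *ₚ H)
  regroup = solve-∀ ℤ[X]ᴬ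
  expand : ∀ Z Y W → (Z -ₚ oneₚ) -ₚ Y *ₚ (W -ₚ oneₚ) ≈ (Z -ₚ Y *ₚ W) +ₚ (Y -ₚ oneₚ)
  expand = solve-∀ ℤ[X]ᴬ

Xⁿ-1-gcd : ∀ a b → Xⁿ-1 (gcd a b) ∈⟨ Xⁿ-1 a , Xⁿ-1 b ⟩
Xⁿ-1-gcd a b with Bézout.identity (gcd-GCD a b)
... | Bézout.+- x y eq = Xⁿ-1-bezout y x eq
... | Bézout.-+ x y eq = ∈-swap (Xⁿ-1-bezout x y eq)

record CyclotomicFacts (n : ℕ) : Set where
  field
    divisorProduct≈ : divisorProduct n n ≈ Xⁿ-1 n
    degree          : ℕ
    monic           : Monic (cyclotomic n) degree
open CyclotomicFacts

FactsBelow : ℕ → Set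
FactsBelow k = ∀ {j} → j < k → CyclotomicFacts (suc j)

factsBelow-mono : ∀ {m k} → m < k → FactsBelow k → FactsBelow m
factsBelow-mono m<k below j<m = below (ℕ.<-trans j<m m<k)

properProduct-*-cyclotomic : ∀ {k} → CyclotomicFacts (suc k) →
  divisorProduct (suc k) k *ₚ cyclotomic (suc k) ≈ Xⁿ-1 (suc k)
properProduct-*-cyclotomic {k} facts = ≈-trans (≈-sym (divisorProduct-suc-∣ (ℕ.∣-refl {suc k}))) (divisorProduct≈ facts)

cyclotomic-∣-Xⁿ-1 : ∀ {k} → CyclotomicFacts (suc k) → cyclotomic (suc k) ∣ Xⁿ-1 (suc k)
cyclotomic-∣-Xⁿ-1 {k} facts = divisorProduct (suc k) k , properProduct-*-cyclotomic facts

divisorProduct-monic : ∀ {k} → FactsBelow k → ∀ n m → m ≤ k → ∃ λ δ → Monic (divisorProduct n m) δ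
divisorProduct-monic below n zero    _   = 0 , Xpow-monic 0
divisorProduct-monic below n (suc m) m<k with suc m ℕ.∣? n | divisorProduct-monic below n m (ℕ.<⇒≤ m<k)
... | yes d∣n | δ , P-monic = δ ℕ.+ degree (below m<k) ,
  monic-resp-≈ (≈-sym (divisorProduct-suc-∣ d∣n)) (monic-*ₚ P-monic (monic (below m<k)))
... | no  d∤n | δ , P-monic = δ , monic-resp-≈ (≈-sym (divisorProduct-suc-∤ d∤n)) P-monic

-- For a proper divisor d of n, X^d - 1 = ∏_{e ∣ d} Φ_e is part of ∏_{e ∣ n, e < n} Φ_e, so
-- Φ_n (X^d - 1) divides X^n - 1 = (X^d - 1) · geom d (n/d).
cyclotomic-∣-geom : ∀ {k g q} → CyclotomicFacts (suc k) → FactsBelow k → g < k → suc k ≡ q ℕ.* suc g →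
  cyclotomic (suc k) ∣ geom (suc g) q
cyclotomic-∣-geom {k} {g} {q} facts below g<k eq = cancel Xᵍ-1∣B
  where
  Xᵍ-1∣B : Xⁿ-1 (suc g) ∣ divisorProduct (suc k) k
  Xᵍ-1∣B = ∣-respˡ (≈-trans (divisorProduct-beyond g g<k) (divisorProduct≈ (below g<k)))
                   (divisorProduct-∣ (ℕ.divides q eq) k)
  *ₚ-assoc-comm : ∀ x r c → x *ₚ (r *ₚ c) ≈ (r *ₚ x) *ₚ c
  *ₚ-assoc-comm = solve-∀ ℤ[X]ᴬ
  cancel : Xⁿ-1 (suc g) ∣ divisorProduct (suc k) k → cyclotomic (suc k) ∣ geom (suc g) q
  cancel (R , RXᵍ≈B) = R , monic-*ₚ-cancelˡ (Xⁿ-1-monic g) (begin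
    Xⁿ-1 (suc g) *ₚ (R *ₚ cyclotomic (suc k))       ≈⟨ *ₚ-assoc-comm (Xⁿ-1 (suc g)) R _ ⟩
    (R *ₚ Xⁿ-1 (suc g)) *ₚ cyclotomic (suc k)       ≈⟨ *ₚ-congˡ (cyclotomic (suc k)) RXᵍ≈B ⟩
    divisorProduct (suc k) k *ₚ cyclotomic (suc k)  ≈⟨ properProduct-*-cyclotomic facts ⟩
    Xⁿ-1 (suc k)                                    ≡⟨ cong Xⁿ-1 eq ⟩
    Xⁿ-1 (q ℕ.* suc g)                              ≈⟨ ≈-sym (Xⁿ-1-*-geom (suc g) q) ⟩
    Xⁿ-1 (suc g) *ₚ geom (suc g) q                  ∎)
    where open ≈-Reasoning

-- With d = gcd(a, b) < a: X^d - 1 lies in the ideal (X^a - 1, X^b - 1) ⊆ (Φ_a, Φ_b), Φ_a divides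
-- T = geom d (a/d), and T ≡ a/d modulo X^d - 1; so the integer a/d lies in (Φ_a, Φ_b).
cyclotomic-coprime : ∀ {k j} → CyclotomicFacts (suc k) → FactsBelow k → j < k →
  CoprimeOverℚ (cyclotomic (suc k)) (cyclotomic (suc j))
cyclotomic-coprime {k} {j} facts below j<k =
  viaGcd (gcd (suc k) (suc j)) (gcd[m,n]∣m (suc k) (suc j)) (gcd[m,n]∣n (suc k) (suc j)) (Xⁿ-1-gcd (suc k) (suc j))
  where
  Φₐ = cyclotomic (suc k)
  Φᵦ = cyclotomic (suc j)
  viaGcd : ∀ d → d ℕ.∣ suc k → d ℕ.∣ suc j → Xⁿ-1 d ∈⟨ Xⁿ-1 (suc k) , Xⁿ-1 (suc j) ⟩ → CoprimeOverℚ Φₐ Φᵦ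
  viaGcd zero    _                      d∣b _   = contradiction (ℕ.0∣⇒≡0 d∣b) λ ()
  viaGcd (suc g) (ℕ.divides zero    ())  _   _
  viaGcd (suc g) (ℕ.divides (suc q) eq) d∣b Xᵈ-1∈ = q , ∈-resp-≈ (p-[p-q]≈q T (const (+ suc q)))
    (∈-- (∣⇒∈ˡ Φᵦ Φₐ∣T) (∣-∈ (∣-difference T≡q)
      (∈-divisors (cyclotomic-∣-Xⁿ-1 facts) (cyclotomic-∣-Xⁿ-1 (below j<k)) Xᵈ-1∈)))
    where
    T = geom (suc g) (suc q)
    Φₐ∣T = cyclotomic-∣-geom {q = suc q} facts below (ℕ.<-≤-trans (ℕ.∣⇒≤ d∣b) j<k) eq
    T≡q : T ≡ const (+ suc q) mod Xⁿ-1 (suc g)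
    T≡q = mod-resp-≈ ≈-refl (geom-zero (suc q)) (geom-mod (suc g) 0 (by-∣ ∣-refl) (suc q))

coprime-divisorProduct : ∀ {k m} → FactsBelow k → m < k → ∀ n m' → m' ≤ m →
  CoprimeOverℚ (cyclotomic (suc m)) (divisorProduct n m')
coprime-divisorProduct below m<k n zero     _ = coprime-oneʳ _
coprime-divisorProduct {k} {m} below m<k n (suc m') m'<m with suc m' ℕ.∣? n
... | yes d∣n = coprime-respʳ (≈-sym (divisorProduct-suc-∣ d∣n))
  (coprime-*ʳ (coprime-divisorProduct below m<k n m' (ℕ.<⇒≤ m'<m))
              (cyclotomic-coprime (below m<k) (factsBelow-mono m<k below) m'<m))
... | no  d∤n = coprime-respʳ (≈-sym (divisorProduct-suc-∤ d∤n)) (coprime-divisorProduct below m<k n m' (ℕ.<⇒≤ m'<m))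

divisorProduct-∣-Xⁿ-1 : ∀ {k} → FactsBelow k → ∀ m → m ≤ k → divisorProduct (suc k) m ∣ Xⁿ-1 (suc k)
divisorProduct-∣-Xⁿ-1 below zero    _   = 1∣ _
divisorProduct-∣-Xⁿ-1 {k} below (suc m) m<k with suc m ℕ.∣? suc k
... | no  d∤n = ∣-respˡ (≈-sym (divisorProduct-suc-∤ d∤n)) (divisorProduct-∣-Xⁿ-1 below m (ℕ.<⇒≤ m<k))
... | yes d∣n = ∣-respˡ (≈-trans (*ₚ-comm (cyclotomic (suc m)) (divisorProduct (suc k) m)) (≈-sym (divisorProduct-suc-∣ d∣n)))
  (coprime-∣-*ₚ (coprime-divisorProduct below m<k (suc k) m ℕ.≤-refl)
                (monic-*ₚ (monic (below m<k)) (proj₂ (divisorProduct-monic below (suc k) m (ℕ.<⇒≤ m<k))))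
                (∣-trans (cyclotomic-∣-Xⁿ-1 (below m<k)) (Xⁿ-1-∣ d∣n))
                (divisorProduct-∣-Xⁿ-1 below m (ℕ.<⇒≤ m<k)))

-- By strong induction: the earlier Φ_d are monic and pairwise coprime and divide X^n - 1, so
-- their product B does; then the long division in cycloList is exact and Φ_n = (X^n - 1) / B.
cyclotomic-facts : ∀ k → CyclotomicFacts (suc k)
cyclotomic-facts = <-rec (CyclotomicFacts ∘ suc) step
  where
  step : ∀ k → FactsBelow k → CyclotomicFacts (suc k)
  step k below = fromQuotient (divisorProduct-∣-Xⁿ-1 below k ℕ.≤-refl)
    where
    B = divisorProduct (suc k) k
    B-monic = proj₂ (divisorProduct-monic below (suc k) k ℕ.≤-refl)
    n<length : suc k < length (Xⁿ-1 (suc k))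
    n<length = nonzero⇒<degreeBound (Xⁿ-1 (suc k)) (degreeBelow-length _) λ z → 1≢0 (trans (sym (Monic.leading (Xⁿ-1-monic k))) z)
    fromQuotient : B ∣ Xⁿ-1 (suc k) → CyclotomicFacts (suc k)
    fromQuotient (Q , QB≈Xⁿ-1) = record
      { divisorProduct≈ = ≈-trans (divisorProduct-suc-∣ (ℕ.∣-refl {suc k})) (≈-trans (*ₚ-congʳ B Φ≈Q) BQ≈Xⁿ-1)
      ; degree          = t
      ; monic           = monic-resp-≈ (≈-sym Φ≈Q) Q-monic }
      where
      BQ≈Xⁿ-1 = ≈-trans (*ₚ-comm B Q) QB≈Xⁿ-1
      quotient = monic-quotient B-monic (Xⁿ-1-monic k) BQ≈Xⁿ-1
      t = proj₁ quotient
      Q-monic = proj₂ (proj₂ quotient)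
      t<fuel : suc t ≤ fuel (suc k)
      t<fuel = s≤s (ℕ.≤-trans (ℕ.≤-trans (ℕ.m≤n+m t _) (ℕ.≤-reflexive (proj₁ (proj₂ quotient)))) (ℕ.<⇒≤ n<length))
      Φ≈Q : cyclotomic (suc k) ≈ Q
      Φ≈Q = subst (_≈ Q) (sym (cyclotomic-suc k))
        (divMonic-exact (fuel (suc k)) B-monic BQ≈Xⁿ-1 (degreeBelow-mono Q t<fuel (Monic.above Q-monic)))

cyclotomic-∣-geom-1 : ∀ k → 0 < k → cyclotomic (suc k) ∣ geom 1 (suc k)
cyclotomic-∣-geom-1 k 0<k =
  cyclotomic-∣-geom {q = suc k} (cyclotomic-facts k) (λ {j} _ → cyclotomic-facts j) 0<k (sym (ℕ.*-identityʳ (suc k)))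

-- Nonzero multiples with coefficients in D

record NonzeroMultiple (D : ℤ → Set) (Q : Poly) : Set where
  constructor nonzeroMultiple
  field
    poly      : Poly
    nonzero   : NonZeroPoly poly
    coeffs-in : CoeffsIn D poly
    divisible : Q ∣ poly

fromΣ : ∀ {D Q} → (Σ Poly λ G → NonZeroPoly G × CoeffsIn D G × Q ∣ₚ G) → NonzeroMultiple D Q
fromΣ {Q = Q} (G , G≢0 , G-in , (W , QW≈G)) = nonzeroMultiple G G≢0 G-in (W , ≈-trans (*ₚ-comm W Q) (pointwise QW≈G))

toΣ : ∀ {D Q} → NonzeroMultiple D Q → Σ Poly λ G → NonZeroPoly G × CoeffsIn D G × Q ∣ₚ G
toΣ {Q = Q} (nonzeroMultiple G G≢0 G-in (W , WQ≈G)) = G , G≢0 , G-in , (W , coeff-≡ (≈-trans (*ₚ-comm Q W) WQ≈G))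

coeff-Xpow-*ₚ-low : ∀ m h {p} → p < m → coeff (Xpow m *ₚ h) p ≡ + 0
coeff-Xpow-*ₚ-low (suc m) h {zero}  _         = coeff-≡ (X·-*ₚ (Xpow m) h) 0
coeff-Xpow-*ₚ-low (suc m) h {suc p} (s≤s p<m) = trans (coeff-≡ (X·-*ₚ (Xpow m) h) (suc p)) (coeff-Xpow-*ₚ-low m h p<m)

coeff-Xpow-*ₚ-high : ∀ m h p → coeff (Xpow m *ₚ h) (m ℕ.+ p) ≡ coeff h p
coeff-Xpow-*ₚ-high zero    h p = coeff-≡ (*ₚ-identityˡ h) p
coeff-Xpow-*ₚ-high (suc m) h p = trans (coeff-≡ (X·-*ₚ (Xpow m) h) (suc (m ℕ.+ p))) (coeff-Xpow-*ₚ-high m h p)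

*ₚ-geom-suc : ∀ F m n → F *ₚ geom m (suc n) ≈ F +ₚ Xpow m *ₚ (F *ₚ geom m n)
*ₚ-geom-suc F m n = expand F (Xpow m) (geom m n)
  where
  expand : ∀ F x g → F *ₚ (oneₚ +ₚ x *ₚ g) ≈ F +ₚ x *ₚ (F *ₚ g)
  expand = solve-∀ ℤ[X]ᴬ

*ₚ-geom-coeff-low : ∀ F {m} n {p} → p < m → coeff (F *ₚ geom m (suc n)) p ≡ coeff F p
*ₚ-geom-coeff-low F {m} n {p} p<m = begin
  coeff (F *ₚ geom m (suc n)) p                    ≡⟨ coeff-≡ (*ₚ-geom-suc F m n) p ⟩
  coeff (F +ₚ Xpow m *ₚ (F *ₚ geom m n)) p          ≡⟨ coeff-+ F _ p ⟩
  coeff F p + coeff (Xpow m *ₚ (F *ₚ geom m n)) p   ≡⟨ cong (_+_ (coeff F p)) (coeff-Xpow-*ₚ-low m _ p<m) ⟩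
  coeff F p + + 0                                   ≡⟨ ℤ.+-identityʳ _ ⟩
  coeff F p                                         ∎
  where open ≡-Reasoning

*ₚ-geom-coeff-high : ∀ F {m} n → DegreeBelow F m → ∀ p → m ≤ p →
  coeff (F *ₚ geom m (suc n)) p ≡ coeff (F *ₚ geom m n) (p ℕ.∸ m)
*ₚ-geom-coeff-high F {m} n F-bound p m≤p = begin
  coeff (F *ₚ geom m (suc n)) p                       ≡⟨ cong (coeff (F *ₚ geom m (suc n))) (sym m+p'≡p) ⟩
  coeff (F *ₚ geom m (suc n)) (m ℕ.+ p')              ≡⟨ coeff-≡ (*ₚ-geom-suc F m n) (m ℕ.+ p') ⟩
  coeff (F +ₚ Xpow m *ₚ (F *ₚ geom m n)) (m ℕ.+ p')    ≡⟨ coeff-+ F _ (m ℕ.+ p') ⟩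
  coeff F (m ℕ.+ p') + coeff (Xpow m *ₚ (F *ₚ geom m n)) (m ℕ.+ p')
                                                      ≡⟨ cong₂ _+_ (F-bound (m ℕ.+ p') (ℕ.m≤m+n m p')) (coeff-Xpow-*ₚ-high m _ p') ⟩
  + 0 + coeff (F *ₚ geom m n) p'                      ≡⟨ ℤ.+-identityˡ _ ⟩
  coeff (F *ₚ geom m n) p'                            ∎
  where
  open ≡-Reasoning
  p' = p ℕ.∸ m
  m+p'≡p : m ℕ.+ p' ≡ p
  m+p'≡p = ℕ.m+[n∸m]≡n m≤p

-- F · geom m n consists of n copies of F shifted by multiples of m, without overlap once deg F < m.
*ₚ-geom-coeff : ∀ (P : ℤ → Set) F {m} → DegreeBelow F m → (∀ j → j < m → P (coeff F j)) →
  ∀ n p → p < n ℕ.* m → P (coeff (F *ₚ geom m n) p)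
*ₚ-geom-coeff P F {m} F-bound F-in (suc n) p p<nm with p ℕ.<? m
... | yes p<m = subst P (sym (*ₚ-geom-coeff-low F n p<m)) (F-in p p<m)
... | no  p≮m = subst P (sym (*ₚ-geom-coeff-high F n F-bound p m≤p))
  (*ₚ-geom-coeff P F F-bound F-in n (p ℕ.∸ m)
    (ℕ.+-cancelˡ-< m _ (n ℕ.* m) (subst (_< suc n ℕ.* m) (sym (ℕ.m+[n∸m]≡n m≤p)) p<nm)))
  where m≤p = ℕ.≮⇒≥ p≮m

*ₚ-geom-degreeBelow : ∀ F {m} → DegreeBelow F m → ∀ n → DegreeBelow (F *ₚ geom m n) (n ℕ.* m)
*ₚ-geom-degreeBelow F {m} F-bound zero    j _    = coeff-≡ (*ₚ-zeroʳ F) j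
*ₚ-geom-degreeBelow F {m} F-bound (suc n) j nm≤j = trans (*ₚ-geom-coeff-high F n F-bound j m≤j)
  (*ₚ-geom-degreeBelow F F-bound n (j ℕ.∸ m)
    (ℕ.+-cancelˡ-≤ m (n ℕ.* m) _ (subst (m ℕ.+ n ℕ.* m ≤_) (sym (ℕ.m+[n∸m]≡n m≤j)) nm≤j)))
  where m≤j = ℕ.≤-trans (ℕ.m≤m+n m (n ℕ.* m)) nm≤j

multiple-with-zero : ∀ {D P Ψ} k → D (+ 0) → NonzeroMultiple D P → Ψ ∣ geom 1 (suc k) → NonzeroMultiple D (P *ₚ Ψ)
multiple-with-zero {D} {P} {Ψ} k D0 (nonzeroMultiple F (i , Fᵢ≢0) F-in P∣F) Ψ∣geom =
  nonzeroMultiple (F *ₚ geom m n) (i , Gᵢ≢0) G-in (∙-cong-∣ P∣F Ψ∣geom-m)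
  where
  n = suc k
  m = suc (length F ℕ.* n)
  F-bound : DegreeBelow F m
  F-bound = degreeBelow-mono F (ℕ.m≤n⇒m≤1+n (ℕ.m≤m*n (length F) n)) (degreeBelow-length F)
  F-all-in : ∀ j → D (coeff F j)
  F-all-in j with coeff F j ℤ.≟ + 0
  ... | yes Fⱼ≡0 = subst D (sym Fⱼ≡0) D0
  ... | no  Fⱼ≢0 = F-in j (j , ℕ.≤-refl , Fⱼ≢0)
  Gᵢ≢0 : ¬ coeff (F *ₚ geom m n) i ≡ + 0
  Gᵢ≢0 z = Fᵢ≢0 (trans (sym (*ₚ-geom-coeff-low F k (nonzero⇒<degreeBound F F-bound Fᵢ≢0))) z)
  G-in : CoeffsIn D (F *ₚ geom m n)
  G-in j _ with j ℕ.<? n ℕ.* m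
  ... | yes j<nm = *ₚ-geom-coeff D F F-bound (λ j _ → F-all-in j) n j j<nm
  ... | no  j≮nm = subst D (sym (*ₚ-geom-degreeBelow F F-bound n j (ℕ.≮⇒≥ j≮nm))) D0
  Ψ∣geom-m : Ψ ∣ geom m n
  Ψ∣geom-m = ∣-mod (∣-trans Ψ∣geom (geom-1-∣-Xⁿ-1 n)) (geom-mod m 1 (Xpow-mod-Xⁿ-1 (length F) n 1) n) Ψ∣geom

multiple-symmetric : ∀ {D P Ψ} k → (∀ x → D x → D (- x)) → NonzeroMultiple D P → Ψ ∣ Xⁿ-1 (suc k) →
  NonzeroMultiple D (P *ₚ Ψ)
multiple-symmetric {D} {P} {Ψ} k D-sym (nonzeroMultiple F F≢0 F-in P∣F) Ψ∣Xⁿ-1 = build (nonZero⇒degree F F≢0)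
  where
  n = suc k
  build : (∃ λ d → ¬ coeff F d ≡ + 0 × DegreeBelow F (suc d)) → NonzeroMultiple D (P *ₚ Ψ)
  build (d , Fd≢0 , F-bound) =
    nonzeroMultiple G (d , Gd≢0) G-in (∣-respʳ rearrange (∣-neg (∣-*ʳ (geom m n) (∙-cong-∣ P∣F Ψ∣Xⁿᵐ-1))))
    where
    m = suc d
    A = F *ₚ geom m n
    G = A -ₚ Xpow (n ℕ.* m) *ₚ A
    F-low : ∀ j → j < m → D (coeff F j)
    F-low j (s≤s j≤d) = F-in j (d , j≤d , Fd≢0)
    coeff-G : ∀ p → coeff G p ≡ coeff A p - coeff (Xpow (n ℕ.* m) *ₚ A) p
    coeff-G p = trans (coeff-+ A _ p) (cong (_+_ (coeff A p)) (coeff-neg (Xpow (n ℕ.* m) *ₚ A) p))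
    G-low : ∀ {p} → p < n ℕ.* m → coeff G p ≡ coeff A p
    G-low {p} p<nm = trans (coeff-G p) (trans (cong (_-_ (coeff A p)) (coeff-Xpow-*ₚ-low (n ℕ.* m) A p<nm)) (ℤ.+-identityʳ _))
    G-high : ∀ p → coeff G (n ℕ.* m ℕ.+ p) ≡ - coeff A p
    G-high p = trans (coeff-G _) (trans
      (cong₂ _-_ (*ₚ-geom-degreeBelow F F-bound n _ (ℕ.m≤m+n _ p)) (coeff-Xpow-*ₚ-high (n ℕ.* m) A p))
      (ℤ.+-identityˡ _))
    G-above : DegreeBelow G (n ℕ.* m ℕ.+ n ℕ.* m)
    G-above l 2nm≤l = trans (cong (coeff G) (sym nm+p≡l)) (trans (G-high _)
      (cong -_ (*ₚ-geom-degreeBelow F F-bound n _ (ℕ.m+n≤o⇒m≤o∸n (n ℕ.* m) 2nm≤l))))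
      where
      nm+p≡l : n ℕ.* m ℕ.+ (l ℕ.∸ n ℕ.* m) ≡ l
      nm+p≡l = ℕ.m+[n∸m]≡n (ℕ.≤-trans (ℕ.m≤m+n (n ℕ.* m) _) 2nm≤l)
    Gd≢0 : ¬ coeff G d ≡ + 0
    Gd≢0 z = Fd≢0 (trans (sym (*ₚ-geom-coeff-low F k (ℕ.≤-refl {m})))
                         (trans (sym (G-low (ℕ.m≤n⇒m≤o*n n (ℕ.≤-refl {m})))) z))
    G-in : CoeffsIn D G
    G-in j (l , j≤l , Gₗ≢0) with j ℕ.<? n ℕ.* m
    ... | yes j<nm = subst D (sym (G-low j<nm)) (*ₚ-geom-coeff D F F-bound F-low n j j<nm)
    ... | no  j≮nm = subst D (sym (trans (cong (coeff G) (sym j≡nm+p)) (G-high p)))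
      (D-sym _ (*ₚ-geom-coeff D F F-bound F-low n p (ℕ.m<n+o⇒m∸n<o j (n ℕ.* m) j<2nm)))
      where
      p = j ℕ.∸ n ℕ.* m
      j≡nm+p : n ℕ.* m ℕ.+ p ≡ j
      j≡nm+p = ℕ.m+[n∸m]≡n (ℕ.≮⇒≥ j≮nm)
      j<2nm : j < n ℕ.* m ℕ.+ n ℕ.* m
      j<2nm = ℕ.≤-<-trans j≤l (nonzero⇒<degreeBound G G-above Gₗ≢0)
    Ψ∣Xⁿᵐ-1 : Ψ ∣ Xⁿ-1 (n ℕ.* m)
    Ψ∣Xⁿᵐ-1 = ∣-trans Ψ∣Xⁿ-1 (Xⁿ-1-∣ {n} (ℕ.divides m (ℕ.*-comm n m)))
    rearrange : -ₚ (F *ₚ Xⁿ-1 (n ℕ.* m) *ₚ geom m n) ≈ G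
    rearrange = identity F (Xpow (n ℕ.* m)) (geom m n)
      where
      identity : ∀ F Y g → -ₚ (F *ₚ (Y -ₚ oneₚ) *ₚ g) ≈ F *ₚ g -ₚ Y *ₚ (F *ₚ g)
      identity = solve-∀ ℤ[X]ᴬ

Symmetric : (ℤ → Set) → Set
Symmetric D = ∀ x → (D x → D (- x)) × (D (- x) → D x)

cyclotomic-multiple : ∀ {D P} → D (+ 0) ⊎ Symmetric D → NonzeroMultiple D P →
  ∀ k → 0 < k → NonzeroMultiple D (P *ₚ cyclotomic (suc k))
cyclotomic-multiple (inj₁ D0)    F k 0<k = multiple-with-zero k D0 F (cyclotomic-∣-geom-1 k 0<k)
cyclotomic-multiple (inj₂ D-sym) F k _   =
  multiple-symmetric k (λ x → proj₁ (D-sym x)) F (cyclotomic-∣-Xⁿ-1 (cyclotomic-facts k))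

proposition3p2 : (D : ℤ → Set) → (∃ λ x → D x)
    → (D (+ 0) ⊎ (∀ x → (D x → D (- x)) × (D (- x) → D x)))
    → (P : Poly)
    → (Σ Poly λ F → NonZeroPoly F × CoeffsIn D F × P ∣ₚ F)
    → ((n : ℕ) → 1 < n
         → Σ Poly λ G → NonZeroPoly G × CoeffsIn D G × (P *ₚ cyclotomic n) ∣ₚ G)
      × ((∀ x → (D x → D (- x)) × (D (- x) → D x))
         → Σ Poly λ G → NonZeroPoly G × CoeffsIn D G × (P *ₚ X-1) ∣ₚ G)
proposition3p2 D _ zero-or-symmetric P F =
  (λ n 1<n → toΣ (cyclotomic-case n 1<n)) , λ D-sym → toΣ (linear-case D-sym)
  where
  cyclotomic-case : (n : ℕ) → 1 < n → NonzeroMultiple D (P *ₚ cyclotomic n)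
  cyclotomic-case (suc k) (s≤s 0<k) = cyclotomic-multiple zero-or-symmetric (fromΣ {Q = P} F) k 0<k
  linear-case : Symmetric D → NonzeroMultiple D (P *ₚ X-1)
  linear-case D-sym = multiple-symmetric 0 (λ x → proj₁ (D-sym x)) (fromΣ {Q = P} F) ∣-refl
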